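{- Let $n$ be a positive integer and $H=([n],E)$ a hypergraph without loops. For $1\le a\le\#E$ and $b\in\mathbb{N}$ let $s(a,b)$ be the number of $a$-element subsets $S\subseteq E$ such that the hypergraph $([n],S)$ has exactly $b$ connected components, and set $s(0,n)=1$ and $s(0,b)=0$ for $b\ne n$. Then for all $0\le i\le n$ and every $0\le m\le\#E$: \[ f_i(\chi_H(k+1))=\sum_{a=0}^{\#E}(-1)^a\sum_{b=0}^{n}s(a,b)\Big(\sum_{c=0}^{i}(-1)^c\binom{i}{c}(i-c+2)^b\Big); \] \[ f_i(\chi_H(k+1))\le\sum_{a=0}^{m}(-1)^a\sum_{b=0}^{n}s(a,b)\Big(\sum_{c=0}^{i}(-1)^c\binom{i}{c}(i-c+2)^b\Big)\quad\text{if } m \text{ is even}; \] \[ f_i(\chi_H(k+1))\ge\sum_{a=0}^{m}(-1)^a\sum_{b=0}^{n}s(a,b)\Big(\sum_{c=0}^{i}(-1)^c\binom{i}{c}(i-c+2)^b\Big)\quad\text{if } m \text{ is odd}. \] Moreover, if $l=\min\{\#F : F\in E\}$ and $n-l+2\le i\le n$, then \[ f_i(\chi_H(k+1))=\sum_{j=0}^{i}(-1)^j\binom{i}{j}(i-j+2)^n. \]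
   Context: A hypergraph $H=([n],E)$ has vertex set $[n]$ and a set $E$ of nonempty subsets of $[n]$ (edges); "without loops" means no edge has cardinality $1$. Connected components of $([n],S)$ are taken with respect to the edges in $S$, with every vertex of $[n]$ not covered by $S$ forming its own component. A proper $k$-coloring of $H$ is a map $c:[n]\to[k]$ such that no edge is monochromatic; $\chi_H(k)$ is the number of proper $k$-colorings (a polynomial in $k$). For a polynomial $p(k)$ of degree at most $n$, its $f$-vector $(f_0(p),\dots,f_n(p))$ is defined by $p(k)=\sum_{i=0}^{n}f_i(p)\binom{k-1}{i}$; here $f_i(\chi_H(k+1))$ denotes the $f$-vector of the polynomial $k\mapsto\chi_H(k+1)$. -}

module Defs where

open import Data.Bool using (Bool; if_then_else_; _∧_)
open import Data.Nat as ℕ using (ℕ; zero; suc; _∸_)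
open import Data.Nat.Combinatorics using (_C_)
open import Data.Integer as ℤ using (ℤ; +_; -_; _^_; _*_; _+_)
open import Data.Fin using (Fin) renaming (_<_ to _<ᶠ_)
open import Data.Fin.Properties using (all?) renaming (_≟_ to _≟ᶠ_; _<?_ to _<ᶠ?_)
open import Data.Fin.Subset using (Subset; _∈_; _∩_; _∪_; ⁅_⁆; ∣_∣; Nonempty; inside; outside)
open import Data.Fin.Subset.Properties using (_∈?_; nonempty?)
open import Data.List as List using (List; _++_; concatMap; length; filter; allFin; foldr)
open import Data.Vec as Vec using ()
open import Data.Vec.Functional as VF using ()
open import Data.Product using (_×_)
open import Relation.Binary.PropositionalEquality using (_≡_)
open import Relation.Nullary using (¬_; Dec; does)
open import Relation.Nullary.Decidable using (_×-dec_; _→-dec_; ¬?)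

-- A hypergraph on the vertex set [n] = Fin n with #E = m edges is given by
-- an injective family  E : Fin m → Subset n  (injectivity = E is a *set*
-- of edges, imposed as a hypothesis in the theorem).  A sub-family
-- S ⊆ E is then given by a  T : Subset m  (S = {E j | j ∈ T}).

allMaps : (n k : ℕ) → List (Fin n → Fin k)
allMaps zero    k = List.[ (λ ()) ]
allMaps (suc n) k = concatMap (λ x → List.map (λ c → x VF.∷ c) (allMaps n k)) (allFin k)

allSubsets : (m : ℕ) → List (Subset m)
allSubsets zero    = List.[ Vec.[] ]
allSubsets (suc m) = List.map (inside Vec.∷_) (allSubsets m)
                  ++ List.map (outside Vec.∷_) (allSubsets m)

Monochromatic : {n k : ℕ} → Subset n → (Fin n → Fin k) → Set
Monochromatic F c = ∀ u v → u ∈ F → v ∈ F → c u ≡ c v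

monochromatic? : {n k : ℕ} (F : Subset n) (c : Fin n → Fin k) → Dec (Monochromatic F c)
monochromatic? F c =
  all? (λ u → all? (λ v → (u ∈? F) →-dec ((v ∈? F) →-dec (c u ≟ᶠ c v))))

Proper : {n m k : ℕ} → (Fin m → Subset n) → (Fin n → Fin k) → Set
Proper E c = ∀ j → ¬ Monochromatic (E j) c

proper? : {n m k : ℕ} (E : Fin m → Subset n) (c : Fin n → Fin k) → Dec (Proper E c)
proper? E c = all? (λ j → ¬? (monochromatic? (E j) c))

χ : {n m : ℕ} → (Fin m → Subset n) → ℕ → ℕ
χ {n} E k = length (filter (proper? E) (allMaps n k))

expand : {n m : ℕ} → (Fin m → Subset n) → Subset m → Subset n → Subset n
expand {m = m} E T R =
  foldr (λ j acc → if does (j ∈? T) ∧ does (nonempty? (E j ∩ R)) then E j ∪ acc else acc)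
        R (allFin m)

iter : {A : Set} → ℕ → (A → A) → A → A
iter zero    g a = a
iter (suc t) g a = g (iter t g a)

-- the connected component of v (vertex set of ([n],S) reachable from v
-- along edges of S); n expansion steps suffice since each non-stationary
-- step adds at least one vertex.  A vertex covered by no edge of S gets
-- the singleton component {v}.
component : {n m : ℕ} → (Fin m → Subset n) → Subset m → Fin n → Subset n
component {n} E T v = iter n (expand E T) ⁅ v ⁆

-- v is the least vertex of its component (one representative per component)
IsRepresentative : {n m : ℕ} → (Fin m → Subset n) → Subset m → Fin n → Set
IsRepresentative E T v = ∀ u → u ∈ component E T v → ¬ (u <ᶠ v)

isRepresentative? : {n m : ℕ} (E : Fin m → Subset n) (T : Subset m) (v : Fin n) →
                    Dec (IsRepresentative E T v)
isRepresentative? E T v = all? (λ u → (u ∈? component E T v) →-dec ¬? (u <ᶠ? v))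

numComponents : {n m : ℕ} → (Fin m → Subset n) → Subset m → ℕ
numComponents {n} E T = length (filter (isRepresentative? E T) (allFin n))

s : {n m : ℕ} → (Fin m → Subset n) → ℕ → ℕ → ℕ
s {n} E zero b with does (b ℕ.≟ n)
... | Bool.true  = 1
... | Bool.false = 0
s {m = m} E (suc a) b =
  length (filter (λ T → (∣ T ∣ ℕ.≟ suc a) ×-dec (numComponents E T ℕ.≟ b)) (allSubsets m))

Σ≤ : ℕ → (ℕ → ℤ) → ℤ
Σ≤ zero    f = f 0
Σ≤ (suc N) f = Σ≤ N f + f (suc N)

sign : ℕ → ℤ
sign a = (- + 1) ^ a

inner : ℕ → ℕ → ℤ
inner i b = Σ≤ i (λ c → sign c * + (i C c) * (+ (i ∸ c ℕ.+ 2)) ^ b)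

partialSum : {n m : ℕ} → (Fin m → Subset n) → ℕ → ℕ → ℤ
partialSum {n} E i M = Σ≤ M (λ a → sign a * Σ≤ n (λ b → + s E a b * inner i b))

-- f-vector of the polynomial p(k) = χ_H(k+1):  p(k) = Σ_{i=0}^{n} f_i C(k-1,i).
-- As an identity of polynomials it is equivalent to its validity at all
-- k = t+1, t ∈ ℕ, i.e.  χ_H(t+2) = Σ_{i=0}^{n} f_i C(t,i).

IsFVectorOfχ+1 : {n m : ℕ} → (Fin m → Subset n) → (ℕ → ℤ) → Set
IsFVectorOfχ+1 {n} E f = ∀ t → + χ E (suc (suc t)) ≡ Σ≤ n (λ i → f i * + (t C i))

module Submission where

-- For a property P of colourings c : [n] → [k] that depends only on the colour classes,
-- write N_P(k) for the number of P-colourings.  Splitting colourings by whether they use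
-- the top colour (and swapping colours) yields a Pascal recursion, whence
-- N_P(t+2) = Σ_i C(t,i) A_P(i), where A_P(i) counts the P-colourings with i+2 colours
-- that use each colour 2,…,i+1.  As binomial transforms are injective, f_i(χ_H(k+1))
-- = A_proper(i).  For P = "monochromatic on every edge of S" one has N_P(k) = k^{#comp(S)},
-- so Newton's forward-difference formula gives A_P(i) = Σ_c (-1)^c C(i,c)(i-c+2)^{#comp(S)}.
-- Rewriting Σ_b s(a,b)(…) as a sum over a-element edge sets S and exchanging sums,
-- partialSum E i M = Σ_c [c uses 2,…,i+1] Σ_{a≤M} (-1)^a C(#mono(c), a), where #mono(c)
-- is the number of monochromatic edges; the inner alternating sum equals [c proper]
-- for M = #E and over-/underestimates it for M even/odd (Bonferroni).  Finally, if
-- i ≥ n-l+2, a colouring using the colours 2,…,i+1 makes no edge of size ≥ l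
-- monochromatic (pigeonhole), so A_proper(i) = A_true(i), the case S = ∅ with #comp = n.

open import Defs
open import Data.Nat as ℕ using (ℕ; zero; suc; _∸_; z≤n; s≤s)
import Data.Nat.Properties as ℕP
open import Data.Nat.Combinatorics using (_C_; nCn≡1; k>n⇒nCk≡0; nCk+nC[k+1]≡[n+1]C[k+1])
open import Data.Nat.Divisibility using (_∣_; divides; ∣m∣n⇒∣m+n; ∣-refl)
open import Data.Integer as ℤ using (ℤ; +_; -_; _*_; _+_; _-_; 0ℤ; 1ℤ)
import Data.Integer.Properties as ℤP
open import Algebra.Bundles using (AbelianGroup)
open import Algebra.Properties.Group (AbelianGroup.group ℤP.+-0-abelianGroup) using () renaming (∙-cancelˡ to +-cancelˡ)
open import Data.Integer.Tactic.RingSolver using (solve-∀)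
open import Data.Fin as Fin using (Fin; zero; suc; toℕ; fromℕ; fromℕ<; inject₁; punchIn; punchOut)
import Data.Fin.Properties as FP
open import Algebra.Properties.CommutativeMonoid.Sum ℤP.+-0-commutativeMonoid
  using (sum; sum-cong-≗; sum-replicate-zero; ∑-distrib-+; sum-init-last; sum-permute)
import Data.Fin.Permutation as Perm
import Data.Fin.Permutation.Components as PC
import Data.Vec.Functional as VF
open import Data.List as List using (List; []; _∷_; _++_; filter; length)
open import Data.List.Membership.Propositional using () renaming (_∈_ to _∈ₗ_)
open import Data.Fin.Subset using (Subset; ∣_∣; _∈_; _∉_; _⊆_; _∩_; _∪_; ⁅_⁆; Nonempty; inside; outside)
  renaming (⊥ to ∅)
open import Data.Fin.Subset.Properties
  using (_∈?_; _⊆?_; nonempty?; x∈p∪q⁺; x∈p∪q⁻; x∈p∩q⁺; x∈p∩q⁻; x∈⁅x⁆; x∈⁅y⁆⇒x≡y; ∣⁅x⁆∣≡1; ⊆-antisym;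
         p⊂q⇒∣p∣<∣q∣; ∣p∣≤n; ∉⊥)
open import Data.List.Relation.Unary.Any using (here; there)
open import Data.List.Membership.Propositional.Properties using (∈-allFin)
open import Data.Bool as Bool using (true; false; if_then_else_; _∧_)
open import Data.Unit using (⊤; tt)
import Data.Vec as Vec
open import Data.Product using (Σ; ∃; _×_; _,_; proj₁; proj₂)
open import Data.Sum using (_⊎_; inj₁; inj₂)
open import Data.Empty using (⊥-elim)
open import Function using (_∘_)
open import Function.Definitions using (Injective)
open import Relation.Binary.PropositionalEquality
open import Relation.Binary.Structures using (IsEquivalence)
open import Relation.Binary.Definitions using (tri<; tri≈; tri>)
open import Relation.Nullary using (¬_; Dec; yes; no; does)
open import Relation.Nullary.Decidable using (_×-dec_; ¬?; _→-dec_)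

Σ≤-cong : ∀ N {f g : ℕ → ℤ} → (∀ i → i ℕ.≤ N → f i ≡ g i) → Σ≤ N f ≡ Σ≤ N g
Σ≤-cong zero    f≡g = f≡g 0 z≤n
Σ≤-cong (suc N) f≡g =
  cong₂ _+_ (Σ≤-cong N (λ i i≤N → f≡g i (ℕP.m≤n⇒m≤1+n i≤N))) (f≡g (suc N) ℕP.≤-refl)

Σ≤-+ : ∀ N (f g : ℕ → ℤ) → Σ≤ N (λ i → f i + g i) ≡ Σ≤ N f + Σ≤ N g
Σ≤-+ zero    f g = refl
Σ≤-+ (suc N) f g =
  trans (cong (_+ (f (suc N) + g (suc N))) (Σ≤-+ N f g))
        (interchange (Σ≤ N f) (Σ≤ N g) (f (suc N)) (g (suc N)))
  where
  interchange : ∀ a b c d → (a + b) + (c + d) ≡ (a + c) + (b + d)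
  interchange = solve-∀

Σ≤-*ˡ : ∀ N z (f : ℕ → ℤ) → Σ≤ N (λ i → z * f i) ≡ z * Σ≤ N f
Σ≤-*ˡ zero    z f = refl
Σ≤-*ˡ (suc N) z f = trans (cong (_+ z * f (suc N)) (Σ≤-*ˡ N z f)) (sym (ℤP.*-distribˡ-+ z _ _))

Σ≤-shift : ∀ N (f : ℕ → ℤ) → Σ≤ (suc N) f ≡ f 0 + Σ≤ N (f ∘ suc)
Σ≤-shift zero    f = refl
Σ≤-shift (suc N) f =
  trans (cong (_+ f (suc (suc N))) (Σ≤-shift N f)) (ℤP.+-assoc (f 0) (Σ≤ N (f ∘ suc)) _)

Σ≤-drop-last : ∀ N (f : ℕ → ℤ) → f (suc N) ≡ 0ℤ → Σ≤ (suc N) f ≡ Σ≤ N f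
Σ≤-drop-last N f f≡0 = trans (cong (λ x → Σ≤ N f + x) f≡0) (ℤP.+-identityʳ _)

Σ≤-zero : ∀ N {f : ℕ → ℤ} → (∀ i → i ℕ.≤ N → f i ≡ 0ℤ) → Σ≤ N f ≡ 0ℤ
Σ≤-zero N f≡0 = trans (Σ≤-cong N f≡0) (lemma N)
  where
  lemma : ∀ N → Σ≤ N (λ _ → 0ℤ) ≡ 0ℤ
  lemma zero    = refl
  lemma (suc N) = cong (_+ 0ℤ) (lemma N)

Σ≤-vanishing-tail : ∀ N N' (f : ℕ → ℤ) → N ℕ.≤ N' → (∀ i → N ℕ.< i → f i ≡ 0ℤ) →
                    Σ≤ N' f ≡ Σ≤ N f
Σ≤-vanishing-tail N zero    f z≤n _  = refl
Σ≤-vanishing-tail N (suc N') f N≤N' f≡0 with N ℕP.≟ suc N'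
... | yes refl = refl
... | no N≢N'  =
  trans (Σ≤-drop-last N' f (f≡0 (suc N') (ℕP.≤∧≢⇒< N≤N' N≢N')))
        (Σ≤-vanishing-tail N N' f (ℕP.≤-pred (ℕP.≤∧≢⇒< N≤N' N≢N')) f≡0)

Σ≤-last-only : ∀ j (f : ℕ → ℤ) → (∀ i → i ℕ.< j → f i ≡ 0ℤ) → Σ≤ j f ≡ f j
Σ≤-last-only zero    f _   = refl
Σ≤-last-only (suc j) f f≡0 =
  trans (cong (_+ f (suc j)) (Σ≤-zero j (λ i i≤j → f≡0 i (s≤s i≤j)))) (ℤP.+-identityˡ _)

Σ≤-single : ∀ N j (f : ℕ → ℤ) → j ℕ.≤ N → (∀ i → ¬ i ≡ j → f i ≡ 0ℤ) → Σ≤ N f ≡ f j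
Σ≤-single N j f j≤N f≡0 =
  trans (Σ≤-vanishing-tail j N f j≤N (λ i j<i → f≡0 i (ℕP.>⇒≢ j<i)))
        (Σ≤-last-only j f (λ i i<j → f≡0 i (ℕP.<⇒≢ i<j)))

-- Binomial transforms

pascal-ℤ : ∀ t i → + (suc t C suc i) ≡ + (t C i) + + (t C suc i)
pascal-ℤ t i = trans (cong +_ (sym (nCk+nC[k+1]≡[n+1]C[k+1] t i))) (ℤP.pos-+ (t C i) (t C suc i))

binomial : (ℕ → ℤ) → ℕ → ℕ → ℤ
binomial x t j = Σ≤ t (λ i → + (t C i) * x (j ℕ.+ i))

binomial-head : ∀ x K N j → Σ≤ (suc N) (λ i → + (K C i) * x (j ℕ.+ i))
                          ≡ x j + Σ≤ N (λ i → + (K C suc i) * x (j ℕ.+ suc i))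
binomial-head x K N j =
  trans (Σ≤-shift N (λ i → + (K C i) * x (j ℕ.+ i)))
        (cong (_+ Σ≤ N (λ i → + (K C suc i) * x (j ℕ.+ suc i)))
              (trans (ℤP.*-identityˡ (x (j ℕ.+ 0))) (cong x (ℕP.+-identityʳ j))))

binomial-shift : ∀ x t j →
  binomial x t j ≡ x j + Σ≤ t (λ i → + (t C suc i) * x (j ℕ.+ suc i))
binomial-shift x t j =
  trans (sym (Σ≤-drop-last t (λ i → + (t C i) * x (j ℕ.+ i))
                (cong (λ w → + w * x (j ℕ.+ suc t)) (k>n⇒nCk≡0 (ℕP.n<1+n t)))))
        (binomial-head x t t j)

binomial-suc : ∀ x t j → binomial x (suc t) j ≡ binomial x t j + binomial x t (suc j)
binomial-suc x t j = begin
    binomial x (suc t) j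
  ≡⟨ binomial-head x (suc t) t j ⟩
    x j + Σ≤ t (λ i → + (suc t C suc i) * x (j ℕ.+ suc i))
  ≡⟨ cong (λ w → x j + w) (trans (Σ≤-cong t split) (Σ≤-+ t _ _)) ⟩
    x j + (binomial x t (suc j) + R)
  ≡⟨ reassoc (x j) (binomial x t (suc j)) R ⟩
    (x j + R) + binomial x t (suc j)
  ≡⟨ cong (_+ binomial x t (suc j)) (sym (binomial-shift x t j)) ⟩
    binomial x t j + binomial x t (suc j) ∎
  where
  open ≡-Reasoning
  R : ℤ
  R = Σ≤ t (λ i → + (t C suc i) * x (j ℕ.+ suc i))
  reassoc : ∀ a b c → a + (b + c) ≡ (a + c) + b
  reassoc = solve-∀
  split : ∀ i → i ℕ.≤ t → + (suc t C suc i) * x (j ℕ.+ suc i)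
                          ≡ + (t C i) * x (suc j ℕ.+ i) + + (t C suc i) * x (j ℕ.+ suc i)
  split i _ = trans (cong (_* x (j ℕ.+ suc i)) (pascal-ℤ t i))
                (trans (ℤP.*-distribʳ-+ (x (j ℕ.+ suc i)) (+ (t C i)) (+ (t C suc i)))
                  (cong (λ k → + (t C i) * x k + + (t C suc i) * x (j ℕ.+ suc i)) (ℕP.+-suc j i)))

pascal-recursion : (a : ℕ → ℕ → ℤ) → (∀ t j → a (suc t) j ≡ a t j + a t (suc j)) →
                   ∀ t j → a t j ≡ binomial (a 0) t j
pascal-recursion a rec zero    j = trans (cong (a 0) (sym (ℕP.+-identityʳ j))) (sym (ℤP.*-identityˡ _))
pascal-recursion a rec (suc t) j =
  trans (rec t j) (trans (cong₂ _+_ (pascal-recursion a rec t j) (pascal-recursion a rec t (suc j)))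
                         (sym (binomial-suc (a 0) t j)))

binomial-injective : (x y : ℕ → ℤ) → (∀ t → binomial x t 0 ≡ binomial y t 0) → ∀ i → x i ≡ y i
binomial-injective x y same i = agree i i ℕP.≤-refl
  where
  agree : ∀ t i → i ℕ.≤ t → x i ≡ y i
  agree zero    .zero z≤n = trans (sym (ℤP.*-identityˡ _)) (trans (same 0) (ℤP.*-identityˡ _))
  agree (suc t) i   i≤t with i ℕP.≟ suc t
  ... | no i≢t   = agree t i (ℕP.≤-pred (ℕP.≤∧≢⇒< i≤t i≢t))
  ... | yes refl = begin
      x (suc t)                       ≡⟨ sym (top x) ⟩
      + (suc t C suc t) * x (suc t)   ≡⟨ +-cancelˡ (lower y) _ _ (trans lower-agree (same (suc t))) ⟩
      + (suc t C suc t) * y (suc t)   ≡⟨ top y ⟩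
      y (suc t)                       ∎
    where
    open ≡-Reasoning
    lower : (ℕ → ℤ) → ℤ
    lower z = Σ≤ t (λ i → + (suc t C i) * z i)
    top : ∀ z → + (suc t C suc t) * z (suc t) ≡ z (suc t)
    top z = trans (cong (λ w → + w * z (suc t)) (nCn≡1 (suc t))) (ℤP.*-identityˡ _)
    lower-agree : lower y + + (suc t C suc t) * x (suc t) ≡ lower x + + (suc t C suc t) * x (suc t)
    lower-agree = cong (_+ + (suc t C suc t) * x (suc t))
                     (sym (Σ≤-cong t (λ i i≤t → cong (+ (suc t C i) *_) (agree t i i≤t))))

-- Forward differences and Newton's formula

sign-suc : ∀ c → sign (suc c) ≡ - sign c
sign-suc c = ℤP.-1*i≡-i (sign c)

Δ : (ℕ → ℤ) → ℕ → ℕ → ℤ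
Δ h zero    t = h t
Δ h (suc j) t = Δ h j (suc t) - Δ h j t

alternating-head : ∀ K N (g : ℕ → ℤ) →
  Σ≤ (suc N) (λ c → sign c * + (K C c) * g c) ≡ g 0 + Σ≤ N (λ c → sign (suc c) * + (K C suc c) * g (suc c))
alternating-head K N g =
  trans (Σ≤-shift N (λ c → sign c * + (K C c) * g c))
        (cong (_+ Σ≤ N (λ c → sign (suc c) * + (K C suc c) * g (suc c))) (ℤP.*-identityˡ (g 0)))

Δ-explicit : ∀ h j t → Δ h j t ≡ Σ≤ j (λ c → sign c * + (j C c) * h (j ∸ c ℕ.+ t))
Δ-explicit h zero    t = sym (ℤP.*-identityˡ (h t))
Δ-explicit h (suc j) t = begin
    Δ h j (suc t) - Δ h j t
  ≡⟨ cong₂ _-_ (trans (Δ-explicit h j (suc t)) (Σ≤-cong j shift-arg)) (Δ-explicit h j t) ⟩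
    Σ≤ j (λ c → sign c * + (j C c) * g c) - B
  ≡⟨ cong (_- B) (trans (sym (Σ≤-drop-last j (λ c → sign c * + (j C c) * g c) top-vanishes))
                        (alternating-head j j g)) ⟩
    (g 0 + Q) - B
  ≡⟨ regroup (g 0) Q B ⟩
    g 0 + (- B + Q)
  ≡⟨ cong (λ w → g 0 + w) (sym pascal-sum) ⟩
    g 0 + Σ≤ j (λ c → sign (suc c) * + (suc j C suc c) * g (suc c))
  ≡⟨ sym (alternating-head (suc j) j g) ⟩
    Σ≤ (suc j) (λ c → sign c * + (suc j C c) * g c) ∎
  where
  open ≡-Reasoning
  g : ℕ → ℤ
  g c = h (suc j ∸ c ℕ.+ t)
  B Q : ℤ
  B = Σ≤ j (λ c → sign c * + (j C c) * g (suc c))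
  Q = Σ≤ j (λ c → sign (suc c) * + (j C suc c) * g (suc c))
  shift-arg : ∀ c → c ℕ.≤ j → sign c * + (j C c) * h (j ∸ c ℕ.+ suc t) ≡ sign c * + (j C c) * g c
  shift-arg c c≤j = cong (λ k → sign c * + (j C c) * h k)
    (trans (ℕP.+-suc (j ∸ c) t) (cong (ℕ._+ t) (sym (ℕP.+-∸-assoc 1 c≤j))))
  top-vanishes : sign (suc j) * + (j C suc j) * g (suc j) ≡ 0ℤ
  top-vanishes = trans (cong (λ w → sign (suc j) * + w * g (suc j)) (k>n⇒nCk≡0 (ℕP.n<1+n j)))
                       (trans (cong (_* g (suc j)) (ℤP.*-zeroʳ (sign (suc j)))) (ℤP.*-zeroˡ (g (suc j))))
  regroup : ∀ a q b → (a + q) - b ≡ a + (- b + q)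
  regroup = solve-∀
  split : ∀ s p q y → (- s) * (p + q) * y ≡ - (s * p * y) + (- s) * q * y
  split = solve-∀
  pascal-signed : ∀ c → sign (suc c) * + (suc j C suc c) * g (suc c)
                      ≡ - (sign c * + (j C c) * g (suc c)) + sign (suc c) * + (j C suc c) * g (suc c)
  pascal-signed c = begin
      sign (suc c) * + (suc j C suc c) * g (suc c)
    ≡⟨ cong₂ (λ u v → u * v * g (suc c)) (sign-suc c) (pascal-ℤ j c) ⟩
      (- sign c) * (+ (j C c) + + (j C suc c)) * g (suc c)
    ≡⟨ split (sign c) (+ (j C c)) (+ (j C suc c)) (g (suc c)) ⟩
      - (sign c * + (j C c) * g (suc c)) + (- sign c) * + (j C suc c) * g (suc c)
    ≡⟨ cong (λ u → - (sign c * + (j C c) * g (suc c)) + u * + (j C suc c) * g (suc c)) (sym (sign-suc c)) ⟩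
      - (sign c * + (j C c) * g (suc c)) + sign (suc c) * + (j C suc c) * g (suc c) ∎
  negate-B : Σ≤ j (λ c → - (sign c * + (j C c) * g (suc c))) ≡ - B
  negate-B = trans (Σ≤-cong j (λ c _ → sym (ℤP.-1*i≡-i _)))
                   (trans (Σ≤-*ˡ j (- 1ℤ) _) (ℤP.-1*i≡-i B))
  pascal-sum : Σ≤ j (λ c → sign (suc c) * + (suc j C suc c) * g (suc c)) ≡ - B + Q
  pascal-sum = trans (Σ≤-cong j (λ c _ → pascal-signed c)) (trans (Σ≤-+ j _ _) (cong (_+ Q) negate-B))

newton : ∀ h t → h t ≡ binomial (λ i → Δ h i 0) t 0
newton h t = pascal-recursion (λ t j → Δ h j t) recursion t 0
  where
  recursion : ∀ t j → Δ h j (suc t) ≡ Δ h j t + Δ h (suc j) t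
  recursion t j = add-difference (Δ h j (suc t)) (Δ h j t)
    where
    add-difference : ∀ x y → x ≡ y + (x - y)
    add-difference = solve-∀

-- the coefficients inner i b are the forward differences of t ↦ (t+2)^b at 0
inner-newton : ∀ b t → binomial (λ i → inner i b) t 0 ≡ (+ (t ℕ.+ 2)) ℤ.^ b
inner-newton b t = sym (trans (newton h t) (Σ≤-cong t (λ i _ → cong (+ (t C i) *_) (Δ≡inner i))))
  where
  h : ℕ → ℤ
  h t = (+ (t ℕ.+ 2)) ℤ.^ b
  Δ≡inner : ∀ i → Δ h i 0 ≡ inner i b
  Δ≡inner i = trans (Δ-explicit h i 0)
    (Σ≤-cong i (λ c _ → cong (λ w → sign c * + (i C c) * (+ (w ℕ.+ 2)) ℤ.^ b) (ℕP.+-identityʳ (i ∸ c))))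

indℕ : ∀ {p} {P : Set p} → Dec P → ℕ
indℕ (yes _) = 1
indℕ (no _)  = 0

ind : ∀ {p} {P : Set p} → Dec P → ℤ
ind d = + indℕ d

indℕ-cong : ∀ {p q} {P : Set p} {Q : Set q} (a : Dec P) (b : Dec Q) → (P → Q) → (Q → P) →
            indℕ a ≡ indℕ b
indℕ-cong (yes _) (yes _) _   _   = refl
indℕ-cong (yes p) (no ¬q) P→Q _   = ⊥-elim (¬q (P→Q p))
indℕ-cong (no ¬p) (yes q) _   Q→P = ⊥-elim (¬p (Q→P q))
indℕ-cong (no _)  (no _)  _   _   = refl

ind-cong : ∀ {p q} {P : Set p} {Q : Set q} (a : Dec P) (b : Dec Q) → (P → Q) → (Q → P) →
           ind a ≡ ind b
ind-cong a b P→Q Q→P = cong +_ (indℕ-cong a b P→Q Q→P)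

ind-yes : ∀ {p} {P : Set p} (a : Dec P) → P → ind a ≡ 1ℤ
ind-yes a p = ind-cong a (yes p) (λ _ → p) (λ _ → p)

ind-no : ∀ {p} {P : Set p} (a : Dec P) → ¬ P → ind a ≡ 0ℤ
ind-no (yes p) ¬p = ⊥-elim (¬p p)
ind-no (no _)  _  = refl

ind-× : ∀ {p q} {P : Set p} {Q : Set q} (a : Dec P) (b : Dec Q) → ind a * ind b ≡ ind (a ×-dec b)
ind-× (yes _) (yes _) = refl
ind-× (yes _) (no _)  = refl
ind-× (no _)  (yes _) = refl
ind-× (no _)  (no _)  = refl

ind-complement : ∀ {p} {P : Set p} (a : Dec P) → ind a + ind (¬? a) ≡ 1ℤ
ind-complement (yes _) = refl
ind-complement (no _)  = refl

ind-*-mono : ∀ {p} {P : Set p} (a : Dec P) {x y : ℤ} → x ℤ.≤ y → ind a * x ℤ.≤ ind a * y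
ind-*-mono (yes _) {x} {y} x≤y = subst₂ ℤ._≤_ (sym (ℤP.*-identityˡ x)) (sym (ℤP.*-identityˡ y)) x≤y
ind-*-mono (no _)          _   = ℤP.≤-refl

-- Partial alternating binomial sums  alt N M = Σ_{a≤M} (-1)^a C(N,a)

alt : ℕ → ℕ → ℤ
alt N M = Σ≤ M (λ a → sign a * + (N C a))

alt-zero : ∀ M → alt 0 M ≡ 1ℤ
alt-zero zero    = refl
alt-zero (suc M) = trans (cong (_+ sign (suc M) * 0ℤ) (alt-zero M))
                         (cong (λ z → 1ℤ + z) (ℤP.*-zeroʳ (sign (suc M))))

alt-suc : ∀ N M → alt (suc N) M ≡ sign M * + (N C M)
alt-suc N zero    = refl
alt-suc N (suc M) = begin
    alt (suc N) M + sign (suc M) * + (suc N C suc M)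
  ≡⟨ cong₂ (λ u v → u + v * + (suc N C suc M)) (alt-suc N M) (sign-suc M) ⟩
    sign M * + (N C M) + (- sign M) * + (suc N C suc M)
  ≡⟨ cong (λ w → sign M * + (N C M) + (- sign M) * w) (pascal-ℤ N M) ⟩
    sign M * + (N C M) + (- sign M) * (+ (N C M) + + (N C suc M))
  ≡⟨ telescope (sign M) (+ (N C M)) (+ (N C suc M)) ⟩
    (- sign M) * + (N C suc M)
  ≡⟨ cong (_* + (N C suc M)) (sym (sign-suc M)) ⟩
    sign (suc M) * + (N C suc M) ∎
  where
  open ≡-Reasoning
  telescope : ∀ s p q → s * p + (- s) * (p + q) ≡ (- s) * q
  telescope = solve-∀

parity : ∀ M → (2 ∣ M) ⊎ (2 ∣ suc M)
parity zero    = inj₁ (divides 0 refl)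
parity (suc M) with parity M
... | inj₁ 2∣M  = inj₂ (∣m∣n⇒∣m+n ∣-refl 2∣M)
... | inj₂ 2∣1+M = inj₁ 2∣1+M

sign-even : ∀ M → 2 ∣ M → sign M ≡ 1ℤ
sign-even .(q ℕ.* 2) (divides q refl) =
  trans (cong sign (ℕP.*-comm q 2)) (trans (sym (ℤP.^-*-assoc (- 1ℤ) 2 q)) (ℤP.^-zeroˡ q))

sign-odd : ∀ M → ¬ (2 ∣ M) → sign M ≡ - 1ℤ
sign-odd M 2∤M with parity M
... | inj₁ 2∣M   = ⊥-elim (2∤M 2∣M)
... | inj₂ 2∣1+M = trans (sym (ℤP.neg-involutive (sign M)))
                         (cong -_ (trans (sym (sign-suc M)) (sign-even (suc M) 2∣1+M)))

alt-complete : ∀ N M → N ℕ.≤ M → alt N M ≡ ind (N ℕP.≟ 0)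
alt-complete zero    M _   = alt-zero M
alt-complete (suc N) M N<M =
  trans (alt-suc N M) (trans (cong (λ w → sign M * + w) (k>n⇒nCk≡0 N<M)) (ℤP.*-zeroʳ (sign M)))

alt-even : ∀ N M → 2 ∣ M → ind (N ℕP.≟ 0) ℤ.≤ alt N M
alt-even zero    M _   = ℤP.≤-reflexive (sym (alt-zero M))
alt-even (suc N) M 2∣M = subst (0ℤ ℤ.≤_)
  (sym (trans (alt-suc N M) (trans (cong (_* + (N C M)) (sign-even M 2∣M)) (ℤP.*-identityˡ _))))
  (ℤ.+≤+ z≤n)

alt-odd : ∀ N M → ¬ (2 ∣ M) → alt N M ℤ.≤ ind (N ℕP.≟ 0)
alt-odd zero    M _   = ℤP.≤-reflexive (alt-zero M)
alt-odd (suc N) M 2∤M = subst (ℤ._≤ 0ℤ)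
  (sym (trans (alt-suc N M) (trans (cong (_* + (N C M)) (sign-odd M 2∤M)) (ℤP.-1*i≡-i _))))
  ℤP.neg-≤-pos

ΣL : {A : Set} → List A → (A → ℤ) → ℤ
ΣL []       f = 0ℤ
ΣL (x ∷ xs) f = f x + ΣL xs f

ΣL-cong : ∀ {A : Set} (xs : List A) {f g : A → ℤ} → (∀ x → f x ≡ g x) → ΣL xs f ≡ ΣL xs g
ΣL-cong []       f≡g = refl
ΣL-cong (x ∷ xs) f≡g = cong₂ _+_ (f≡g x) (ΣL-cong xs f≡g)

ΣL-zero : ∀ {A : Set} (xs : List A) {f : A → ℤ} → (∀ x → f x ≡ 0ℤ) → ΣL xs f ≡ 0ℤ
ΣL-zero []       f≡0 = refl
ΣL-zero (x ∷ xs) f≡0 = cong₂ _+_ (f≡0 x) (ΣL-zero xs f≡0)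

ΣL-+ : ∀ {A : Set} (xs : List A) (f g : A → ℤ) → ΣL xs (λ x → f x + g x) ≡ ΣL xs f + ΣL xs g
ΣL-+ []       f g = refl
ΣL-+ (x ∷ xs) f g =
  trans (cong (λ z → f x + g x + z) (ΣL-+ xs f g)) (interchange (f x) (g x) (ΣL xs f) (ΣL xs g))
  where
  interchange : ∀ a b c d → (a + b) + (c + d) ≡ (a + c) + (b + d)
  interchange = solve-∀

ΣL-*ˡ : ∀ {A : Set} (xs : List A) z (f : A → ℤ) → ΣL xs (λ x → z * f x) ≡ z * ΣL xs f
ΣL-*ˡ []       z f = sym (ℤP.*-zeroʳ z)
ΣL-*ˡ (x ∷ xs) z f = trans (cong (λ w → z * f x + w) (ΣL-*ˡ xs z f)) (sym (ℤP.*-distribˡ-+ z (f x) _))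

ΣL-*ʳ : ∀ {A : Set} (xs : List A) z (f : A → ℤ) → ΣL xs f * z ≡ ΣL xs (λ x → f x * z)
ΣL-*ʳ xs z f = trans (ℤP.*-comm (ΣL xs f) z)
                     (trans (sym (ΣL-*ˡ xs z f)) (ΣL-cong xs (λ x → ℤP.*-comm z (f x))))

ΣL-mono : ∀ {A : Set} (xs : List A) {f g : A → ℤ} → (∀ x → f x ℤ.≤ g x) → ΣL xs f ℤ.≤ ΣL xs g
ΣL-mono []       f≤g = ℤP.≤-refl
ΣL-mono (x ∷ xs) f≤g = ℤP.+-mono-≤ (f≤g x) (ΣL-mono xs f≤g)

ΣL-++ : ∀ {A : Set} (xs ys : List A) f → ΣL (xs ++ ys) f ≡ ΣL xs f + ΣL ys f
ΣL-++ []       ys f = sym (ℤP.+-identityˡ _)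
ΣL-++ (x ∷ xs) ys f = trans (cong (λ z → f x + z) (ΣL-++ xs ys f)) (sym (ℤP.+-assoc (f x) _ _))

ΣL-map : ∀ {A B : Set} (g : A → B) (xs : List A) f → ΣL (List.map g xs) f ≡ ΣL xs (f ∘ g)
ΣL-map g []       f = refl
ΣL-map g (x ∷ xs) f = cong (λ z → f (g x) + z) (ΣL-map g xs f)

ΣL-concatMap : ∀ {A B : Set} (h : A → List B) (xs : List A) f →
               ΣL (List.concatMap h xs) f ≡ ΣL xs (λ x → ΣL (h x) f)
ΣL-concatMap h []       f = refl
ΣL-concatMap h (x ∷ xs) f = trans (ΣL-++ (h x) _ f) (cong (λ z → ΣL (h x) f + z) (ΣL-concatMap h xs f))

ΣL-tabulate : ∀ {A : Set} {k} (g : Fin k → A) f → ΣL (List.tabulate g) f ≡ sum (f ∘ g)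
ΣL-tabulate {k = zero}  g f = refl
ΣL-tabulate {k = suc k} g f = cong (λ z → f (g zero) + z) (ΣL-tabulate (g ∘ suc) f)

ΣL-Σ≤ : ∀ {A : Set} (xs : List A) N (F : ℕ → A → ℤ) →
        ΣL xs (λ x → Σ≤ N (λ b → F b x)) ≡ Σ≤ N (λ b → ΣL xs (F b))
ΣL-Σ≤ xs zero    F = refl
ΣL-Σ≤ xs (suc N) F = trans (ΣL-+ xs (λ x → Σ≤ N (λ b → F b x)) (F (suc N)))
                           (cong (_+ ΣL xs (F (suc N))) (ΣL-Σ≤ xs N F))

ΣL-comm : ∀ {A B : Set} (xs : List A) (ys : List B) (F : A → B → ℤ) →
          ΣL xs (λ x → ΣL ys (F x)) ≡ ΣL ys (λ y → ΣL xs (λ x → F x y))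
ΣL-comm []       ys F = sym (ΣL-zero ys (λ _ → refl))
ΣL-comm (x ∷ xs) ys F =
  trans (cong (λ z → ΣL ys (F x) + z) (ΣL-comm xs ys F)) (sym (ΣL-+ ys (F x) _))

ΣL-sum : ∀ {A : Set} (xs : List A) {k} (F : A → Fin k → ℤ) →
         ΣL xs (λ x → sum (F x)) ≡ sum (λ y → ΣL xs (λ x → F x y))
ΣL-sum []       {k} F = sym (sum-replicate-zero k)
ΣL-sum (x ∷ xs)     F =
  trans (cong (λ z → sum (F x) + z) (ΣL-sum xs F)) (sym (∑-distrib-+ (F x) _))

length-filter : ∀ {A : Set} {P : A → Set} (P? : ∀ x → Dec (P x)) (xs : List A) →
                + length (filter P? xs) ≡ ΣL xs (λ x → ind (P? x))
length-filter P? []       = refl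
length-filter P? (x ∷ xs) with P? x
... | yes _ = trans (ℤP.pos-+ 1 (length (filter P? xs))) (cong (λ z → 1ℤ + z) (length-filter P? xs))
... | no _  = trans (length-filter P? xs) (sym (ℤP.+-identityˡ _))

Σ≤-delta : ∀ N j (g : ℕ → ℤ) → j ℕ.≤ N → Σ≤ N (λ b → ind (j ℕP.≟ b) * g b) ≡ g j
Σ≤-delta N j g j≤N =
  trans (Σ≤-single N j _ j≤N (λ b b≢j → trans (cong (_* g b) (ind-no (j ℕP.≟ b) (b≢j ∘ sym))) (ℤP.*-zeroˡ (g b))))
        (trans (cong (_* g j) (ind-yes (j ℕP.≟ j) refl)) (ℤP.*-identityˡ (g j)))

sum-*ˡ : ∀ {k} z (f : Fin k → ℤ) → sum (λ x → z * f x) ≡ z * sum f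
sum-*ˡ {zero}  z f = sym (ℤP.*-zeroʳ z)
sum-*ˡ {suc k} z f = trans (cong (λ w → z * f zero + w) (sum-*ˡ z (f ∘ suc))) (sym (ℤP.*-distribˡ-+ z _ _))

sum-const : ∀ k z → sum {k} (λ _ → z) ≡ + k * z
sum-const k z = trans (sum-cong-≗ {k} (λ _ → sym (ℤP.*-identityʳ z)))
                      (trans (sum-*ˡ {k} z (λ _ → 1ℤ)) (trans (ℤP.*-comm z _) (cong (_* z) (ones k))))
  where
  ones : ∀ k → sum {k} (λ _ → 1ℤ) ≡ + k
  ones zero    = refl
  ones (suc k) = trans (cong (λ w → 1ℤ + w) (ones k)) (sym (ℤP.pos-+ 1 k))

sum-delta : ∀ {k} (y : Fin k) → sum (λ x → ind (x FP.≟ y)) ≡ 1ℤ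
sum-delta {suc k} zero =
  cong (λ w → 1ℤ + w) (trans (sum-cong-≗ {k} (λ x → ind-no (suc x FP.≟ zero) (λ ()))) (sum-replicate-zero k))
sum-delta {suc k} (suc y) =
  trans (cong (_+ sum (λ x → ind (suc x FP.≟ suc y))) (ind-no (zero FP.≟ suc y) (λ ())))
        (trans (ℤP.+-identityˡ _)
               (trans (sum-cong-≗ (λ x → ind-cong (suc x FP.≟ suc y) (x FP.≟ y) FP.suc-injective (cong suc)))
                      (sum-delta y)))

Colouring : ℕ → ℕ → Set
Colouring n k = Fin n → Fin k

Σc : ∀ n k → (Colouring n k → ℤ) → ℤ
Σc n k = ΣL (allMaps n k)

Σc-suc : ∀ n k (F : Colouring (suc n) k → ℤ) → Σc (suc n) k F ≡ sum (λ x → Σc n k (λ c → F (x VF.∷ c)))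
Σc-suc n k F =
  trans (ΣL-concatMap (λ x → List.map (x VF.∷_) (allMaps n k)) (List.allFin k) F)
        (trans (ΣL-tabulate {k = k} (λ x → x) _) (sum-cong-≗ {k} (λ x → ΣL-map (x VF.∷_) (allMaps n k) F)))

-- F respects pointwise equality of colourings (the stand-in for extensionality)
Respects≗ : ∀ {n k} → (Colouring n k → ℤ) → Set
Respects≗ {n} {k} F = ∀ (c c' : Colouring n k) → (∀ u → c u ≡ c' u) → F c ≡ F c'

noColours : ∀ {k} → Colouring 0 k
noColours ()

Σc-zero : ∀ k (F : Colouring 0 k → ℤ) → Respects≗ F → ∀ c → Σc 0 k F ≡ F c
Σc-zero k F resp c = trans (ℤP.+-identityʳ _) (resp _ c (λ ()))

cons-cong : ∀ {n k} (y : Fin k) {c c' : Colouring n k} → (∀ u → c u ≡ c' u) →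
            ∀ u → (y VF.∷ c) u ≡ (y VF.∷ c') u
cons-cong y c≗c' zero    = refl
cons-cong y c≗c' (suc u) = c≗c' u

Σc-relabel : ∀ n k (σ τ : Fin k → Fin k) → (∀ y → σ (τ y) ≡ y) → (∀ y → τ (σ y) ≡ y) →
             (F : Colouring n k → ℤ) → Respects≗ F → Σc n k (λ c → F (σ ∘ c)) ≡ Σc n k F
Σc-relabel zero    k σ τ στ τσ F resp =
  trans (Σc-zero k (λ c → F (σ ∘ c)) (λ c c' _ → resp (σ ∘ c) (σ ∘ c') (λ ())) noColours)
        (sym (Σc-zero k F resp (σ ∘ noColours)))
Σc-relabel (suc n) k σ τ στ τσ F resp = begin
    Σc (suc n) k (λ c → F (σ ∘ c))
  ≡⟨ Σc-suc n k _ ⟩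
    sum (λ x → Σc n k (λ c → F (σ ∘ (x VF.∷ c))))
  ≡⟨ sum-cong-≗ {k} (λ x → trans (ΣL-cong (allMaps n k) (λ c → resp _ _ (relabel-cons x c)))
                                 (Σc-relabel n k σ τ στ τσ (F-from (σ x)) (resp-from (σ x)))) ⟩
    sum (λ x → Σc n k (F-from (σ x)))
  ≡⟨ sym (sum-permute (λ y → Σc n k (F-from y)) (Perm.permutation σ τ στ τσ)) ⟩
    sum (λ y → Σc n k (F-from y))
  ≡⟨ sym (Σc-suc n k F) ⟩
    Σc (suc n) k F ∎
  where
  open ≡-Reasoning
  F-from : Fin k → Colouring n k → ℤ
  F-from y c = F (y VF.∷ c)
  resp-from : ∀ y → Respects≗ (F-from y)
  resp-from y c c' c≗c' = resp _ _ (cons-cong y c≗c')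
  relabel-cons : ∀ x c u → (σ ∘ (x VF.∷ c)) u ≡ (σ x VF.∷ (σ ∘ c)) u
  relabel-cons x c zero    = refl
  relabel-cons x c (suc u) = refl

AvoidsTop : ∀ {n K} → Colouring n (suc K) → Set
AvoidsTop {n} {K} c = ∀ v → ¬ c v ≡ fromℕ K

avoidsTop? : ∀ {n K} (c : Colouring n (suc K)) → Dec (AvoidsTop c)
avoidsTop? {K = K} c = FP.all? (λ v → ¬? (c v FP.≟ fromℕ K))

Σc-avoidsTop : ∀ n K (F : Colouring n (suc K) → ℤ) → Respects≗ F →
               Σc n (suc K) (λ c → ind (avoidsTop? c) * F c) ≡ Σc n K (λ c → F (inject₁ ∘ c))
Σc-avoidsTop zero    K F resp =
  trans (Σc-zero (suc K) _ (λ c c' e → cong₂ _*_ (ind-cong (avoidsTop? c) (avoidsTop? c') (λ _ ()) (λ _ ()))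
                                                 (resp c c' e)) noColours)
        (trans (cong (_* F noColours) (ind-yes (avoidsTop? {0} {K} noColours) (λ ())))
               (trans (trans (ℤP.*-identityˡ _) (resp noColours (inject₁ ∘ noColours) (λ ())))
                      (sym (Σc-zero K (λ c → F (inject₁ ∘ c)) (λ c c' _ → resp (inject₁ ∘ c) (inject₁ ∘ c') (λ ()))
                                    noColours))))
Σc-avoidsTop (suc n) K F resp = begin
    Σc (suc n) (suc K) (λ c → ind (avoidsTop? c) * F c)
  ≡⟨ trans (Σc-suc n (suc K) _) (sum-init-last G) ⟩
    sum (λ y → G (inject₁ y)) + G (fromℕ K)
  ≡⟨ cong₂ _+_ (sum-cong-≗ {K} G-inject₁) G-top ⟩
    sum (λ y → Σc n K (λ c → F (inject₁ ∘ (y VF.∷ c)))) + 0ℤ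
  ≡⟨ trans (ℤP.+-identityʳ _) (sym (Σc-suc n K _)) ⟩
    Σc (suc n) K (λ c → F (inject₁ ∘ c)) ∎
  where
  open ≡-Reasoning
  G : Fin (suc K) → ℤ
  G x = Σc n (suc K) (λ c → ind (avoidsTop? (x VF.∷ c)) * F (x VF.∷ c))
  G-top : G (fromℕ K) ≡ 0ℤ
  G-top = ΣL-zero (allMaps n (suc K))
    (λ c → cong (_* F (fromℕ K VF.∷ c)) (ind-no (avoidsTop? (fromℕ K VF.∷ c)) (λ avoids → avoids zero refl)))
  avoids-cons : ∀ y (c : Colouring n (suc K)) →
                ind (avoidsTop? (inject₁ y VF.∷ c)) * F (inject₁ y VF.∷ c) ≡ ind (avoidsTop? c) * F (inject₁ y VF.∷ c)
  avoids-cons y c = cong (_* F (inject₁ y VF.∷ c))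
    (ind-cong (avoidsTop? (inject₁ y VF.∷ c)) (avoidsTop? c) (λ avoids v → avoids (suc v))
              (λ { avoids zero → λ e → FP.fromℕ≢inject₁ (sym e) ; avoids (suc v) → avoids v }))
  G-inject₁ : ∀ y → G (inject₁ y) ≡ Σc n K (λ c → F (inject₁ ∘ (y VF.∷ c)))
  G-inject₁ y =
    trans (ΣL-cong (allMaps n (suc K)) (avoids-cons y))
      (trans (Σc-avoidsTop n K (λ c → F (inject₁ y VF.∷ c)) (λ c c' e → resp _ _ (cons-cong (inject₁ y) e)))
             (ΣL-cong (allMaps n K) (λ c → resp _ _ (λ { zero → refl ; (suc u) → refl }))))

transpose-right : ∀ {K} (a b : Fin K) → PC.transpose a b b ≡ a
transpose-right a b with b FP.≟ a
... | yes b≡a = b≡a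
... | no _ with b FP.≟ b
...   | yes _   = refl
...   | no b≢b  = ⊥-elim (b≢b refl)

transpose-other : ∀ {K} (a b y : Fin K) → ¬ y ≡ a → ¬ y ≡ b → PC.transpose a b y ≡ y
transpose-other a b y y≢a y≢b with y FP.≟ a
... | yes y≡a = ⊥-elim (y≢a y≡a)
... | no _ with y FP.≟ b
...   | yes y≡b = ⊥-elim (y≢b y≡b)
...   | no _    = refl

transpose-injective : ∀ {K} (a b : Fin K) {x y : Fin K} → PC.transpose a b x ≡ PC.transpose a b y → x ≡ y
transpose-injective a b {x} {y} e =
  trans (sym (PC.transpose-inverse b a)) (trans (cong (PC.transpose b a) e) (PC.transpose-inverse b a))

Coarser : ∀ {n k k'} → Colouring n k → Colouring n k' → Set
Coarser c c' = ∀ u v → c u ≡ c v → c' u ≡ c' v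

ClassInvariant : ∀ {n} → (∀ {k} → Colouring n k → Set) → Set
ClassInvariant {n} P = ∀ {k k'} (c : Colouring n k) (c' : Colouring n k') →
                       Coarser c c' → Coarser c' c → P c → P c'

coarser-pointwise : ∀ {n k} {c c' : Colouring n k} → (∀ u → c u ≡ c' u) → Coarser c c'
coarser-pointwise c≗c' u v cu≡cv = trans (sym (c≗c' u)) (trans cu≡cv (c≗c' v))

invariant-relabel : ∀ {n k k'} {P : ∀ {k} → Colouring n k → Set} → ClassInvariant P →
                    (c : Colouring n k) (f : Fin k → Fin k') → (∀ {x y} → f x ≡ f y → x ≡ y) → P c → P (f ∘ c)
invariant-relabel inv c f f-inj = inv c (f ∘ c) (λ u v → cong f) (λ u v → f-inj)

invariant-unrelabel : ∀ {n k k'} {P : ∀ {k} → Colouring n k → Set} → ClassInvariant P →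
                      (c : Colouring n k) (f : Fin k → Fin k') → (∀ {x y} → f x ≡ f y → x ≡ y) → P (f ∘ c) → P c
invariant-unrelabel inv c f f-inj = inv (f ∘ c) c (λ u v → f-inj) (λ u v → cong f)

-- Splitting colourings by the colours they use

UsesColours : ∀ {n k} → ℕ → Colouring n k → Set
UsesColours j c = ∀ (x : Fin j) → ∃ λ v → toℕ (c v) ≡ suc (suc (toℕ x))

usesColours? : ∀ {n k} (j : ℕ) (c : Colouring n k) → Dec (UsesColours j c)
usesColours? j c = FP.all? (λ x → FP.any? (λ v → toℕ (c v) ℕP.≟ suc (suc (toℕ x))))

usesColours-pointwise : ∀ {n k} j {c c' : Colouring n k} → (∀ u → c u ≡ c' u) →
                        UsesColours j c → UsesColours j c'
usesColours-pointwise j c≗c' uses x = proj₁ (uses x) , trans (cong toℕ (sym (c≗c' _))) (proj₂ (uses x))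

-- Swapping the colours j+2 and K (with j+2 ≤ K) turns "uses 2,…,j+1 and the top colour K"
-- into "uses 2,…,j+2".
module SwapTop {n K j : ℕ} (j+2≤K : suc (suc j) ℕ.≤ K) where

  a b : Fin (suc K)
  a = fromℕ< (s≤s j+2≤K)
  b = fromℕ K

  σ : Fin (suc K) → Fin (suc K)
  σ = PC.transpose a b

  toℕ-a : toℕ a ≡ suc (suc j)
  toℕ-a = FP.toℕ-fromℕ< (s≤s j+2≤K)

  σ-fixes : ∀ y x → x ℕ.< j → toℕ y ≡ suc (suc x) → σ y ≡ y
  σ-fixes y x x<j y≡x+2 = transpose-other a b y
    (λ y≡a → ℕP.<-irrefl (trans (sym y≡x+2) (trans (cong toℕ y≡a) toℕ-a)) (s≤s (s≤s x<j)))
    (λ y≡b → ℕP.<-irrefl (trans (sym y≡x+2) (trans (cong toℕ y≡b) (FP.toℕ-fromℕ K)))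
                          (ℕP.<-≤-trans (s≤s (s≤s x<j)) j+2≤K))

  uses-after-swap : (c : Colouring n (suc K)) → ¬ AvoidsTop c → UsesColours j c → UsesColours (suc j) (σ ∘ c)
  uses-after-swap c uses-top uses x with toℕ x ℕP.<? j
  ... | yes x<j = v , trans (cong toℕ (σ-fixes (c v) (toℕ x) x<j cv≡x+2)) cv≡x+2
    where
    v : Fin n
    v = proj₁ (uses (fromℕ< x<j))
    cv≡x+2 : toℕ (c v) ≡ suc (suc (toℕ x))
    cv≡x+2 = trans (proj₂ (uses (fromℕ< x<j))) (cong (λ w → suc (suc w)) (FP.toℕ-fromℕ< x<j))
  ... | no x≮j with FP.any? (λ v → c v FP.≟ b)
  ...   | yes (v , cv≡b) = v , trans (cong toℕ (trans (cong σ cv≡b) (transpose-right a b)))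
                                     (trans toℕ-a (cong (λ w → suc (suc w)) (sym x≡j)))
    where
    x≡j : toℕ x ≡ j
    x≡j = ℕP.≤-antisym (ℕP.≤-pred (FP.toℕ<n x)) (ℕP.≮⇒≥ x≮j)
  ...   | no ¬top = ⊥-elim (uses-top (λ v cv≡b → ¬top (v , cv≡b)))

  uses-before-swap : (c : Colouring n (suc K)) → UsesColours (suc j) (σ ∘ c) → UsesColours j c
  uses-before-swap c uses x = v , trans (cong toℕ σcv≡cv) σcv≡x+2
    where
    v : Fin n
    v = proj₁ (uses (inject₁ x))
    σcv≡x+2 : toℕ (σ (c v)) ≡ suc (suc (toℕ x))
    σcv≡x+2 = trans (proj₂ (uses (inject₁ x))) (cong (λ w → suc (suc w)) (FP.toℕ-inject₁ x))
    σcv≡cv : c v ≡ σ (c v)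
    σcv≡cv = sym (transpose-injective a b (σ-fixes (σ (c v)) (toℕ x) (FP.toℕ<n x) σcv≡x+2))

  top-before-swap : (c : Colouring n (suc K)) → UsesColours (suc j) (σ ∘ c) → ¬ AvoidsTop c
  top-before-swap c uses avoids =
    avoids v (trans (sym (PC.transpose-inverse b a)) (trans (cong (PC.transpose b a) σcv≡a) (transpose-right b a)))
    where
    v : Fin n
    v = proj₁ (uses (fromℕ j))
    σcv≡a : σ (c v) ≡ a
    σcv≡a = FP.toℕ-injective (trans (proj₂ (uses (fromℕ j)))
                                    (trans (cong (λ w → suc (suc w)) (FP.toℕ-fromℕ j)) (sym toℕ-a)))

module ColourUsage (n : ℕ) (P : ∀ {k} → Colouring n k → Set)
                   (P? : ∀ {k} (c : Colouring n k) → Dec (P c)) (inv : ClassInvariant P) where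

  A : ℕ → ℕ → ℤ
  A k j = Σc n k (λ c → ind (usesColours? j c) * ind (P? c))

  weight-resp : ∀ {k} j → Respects≗ {n} {k} (λ c → ind (usesColours? j c) * ind (P? c))
  weight-resp j c c' c≗c' = cong₂ _*_
    (ind-cong (usesColours? j c) (usesColours? j c')
              (usesColours-pointwise j c≗c') (usesColours-pointwise j (sym ∘ c≗c')))
    (ind-cong (P? c) (P? c') (inv c c' (coarser-pointwise c≗c') (coarser-pointwise (sym ∘ c≗c')))
                             (inv c' c (coarser-pointwise (sym ∘ c≗c')) (coarser-pointwise c≗c')))

  -- colourings avoiding the top colour K are counted by A K j …
  avoiding-top : ∀ K j → Σc n (suc K) (λ c → ind (avoidsTop? c) * (ind (usesColours? j c) * ind (P? c))) ≡ A K j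
  avoiding-top K j =
    trans (Σc-avoidsTop n K _ (weight-resp j))
          (ΣL-cong (allMaps n K) (λ c → cong₂ _*_
             (ind-cong (usesColours? j (inject₁ ∘ c)) (usesColours? j c)
                       (λ uses x → proj₁ (uses x) , trans (sym (FP.toℕ-inject₁ _)) (proj₂ (uses x)))
                       (λ uses x → proj₁ (uses x) , trans (FP.toℕ-inject₁ _) (proj₂ (uses x))))
             (ind-cong (P? (inject₁ ∘ c)) (P? c) (invariant-unrelabel inv c inject₁ FP.inject₁-injective)
                                                 (invariant-relabel inv c inject₁ FP.inject₁-injective))))

  -- … and, after swapping colours j+2 and K, the others are counted by A (K+1) (j+1)
  using-top : ∀ K j → suc (suc j) ℕ.≤ K →
              Σc n (suc K) (λ c → ind (¬? (avoidsTop? c)) * (ind (usesColours? j c) * ind (P? c))) ≡ A (suc K) (suc j)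
  using-top K j j+2≤K =
    trans (ΣL-cong (allMaps n (suc K)) weight-swap)
          (Σc-relabel n (suc K) σ (PC.transpose b a) (λ _ → PC.transpose-inverse _ _) (λ _ → PC.transpose-inverse _ _)
                      (λ c → ind (usesColours? (suc j) c) * ind (P? c)) (weight-resp (suc j)))
    where
    open SwapTop {n} {K} {j} j+2≤K
    weight-swap : ∀ c → ind (¬? (avoidsTop? c)) * (ind (usesColours? j c) * ind (P? c))
                      ≡ ind (usesColours? (suc j) (σ ∘ c)) * ind (P? (σ ∘ c))
    weight-swap c =
      trans (cong (ind (¬? (avoidsTop? c)) *_) (ind-× (usesColours? j c) (P? c)))
        (trans (ind-× (¬? (avoidsTop? c)) (usesColours? j c ×-dec P? c))
          (trans (ind-cong (¬? (avoidsTop? c) ×-dec (usesColours? j c ×-dec P? c))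
                           (usesColours? (suc j) (σ ∘ c) ×-dec P? (σ ∘ c))
                           (λ { (top , uses , p) → uses-after-swap c top uses , invariant-relabel inv c σ σ-injective p })
                           (λ { (uses , p) → top-before-swap c uses , uses-before-swap c uses ,
                                             invariant-unrelabel inv c σ σ-injective p }))
                 (sym (ind-× (usesColours? (suc j) (σ ∘ c)) (P? (σ ∘ c))))))
      where
      σ-injective : ∀ {x y} → σ x ≡ σ y → x ≡ y
      σ-injective = transpose-injective a b

  A-recursion : ∀ K j → suc (suc j) ℕ.≤ K → A (suc K) j ≡ A K j + A (suc K) (suc j)
  A-recursion K j j+2≤K =
    trans (ΣL-cong (allMaps n (suc K)) split-by-top)
          (trans (ΣL-+ (allMaps n (suc K)) _ _) (cong₂ _+_ (avoiding-top K j) (using-top K j j+2≤K)))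
    where
    split-by-top : ∀ c → ind (usesColours? j c) * ind (P? c)
                       ≡ ind (avoidsTop? c) * (ind (usesColours? j c) * ind (P? c))
                         + ind (¬? (avoidsTop? c)) * (ind (usesColours? j c) * ind (P? c))
    split-by-top c = trans (sym (ℤP.*-identityˡ w))
      (trans (cong (_* w) (sym (ind-complement (avoidsTop? c))))
             (ℤP.*-distribʳ-+ w (ind (avoidsTop? c)) (ind (¬? (avoidsTop? c)))))
      where w = ind (usesColours? j c) * ind (P? c)

  decomposition : ∀ t → Σc n (suc (suc t)) (λ c → ind (P? c)) ≡ binomial (λ i → A (suc (suc i)) i) t 0
  decomposition t =
    trans (sym row-t) (trans (pascal-recursion a recursion t 0)
          (Σ≤-cong t (λ i _ → cong (λ w → + (t C i) * A (suc (suc w)) i) (ℕP.+-identityʳ i))))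
    where
    a : ℕ → ℕ → ℤ
    a t j = A (suc (suc (j ℕ.+ t))) j
    recursion : ∀ t j → a (suc t) j ≡ a t j + a t (suc j)
    recursion t j = trans (cong (λ w → A (suc (suc w)) j) (ℕP.+-suc j t))
                          (A-recursion (suc (suc (j ℕ.+ t))) j (s≤s (s≤s (ℕP.m≤m+n j t))))
    row-t : a t 0 ≡ Σc n (suc (suc t)) (λ c → ind (P? c))
    row-t = ΣL-cong (allMaps n (suc (suc t)))
              (λ c → trans (cong (_* ind (P? c)) (ind-yes (usesColours? 0 c) (λ ()))) (ℤP.*-identityˡ _))

count : ∀ {n} {P : Fin n → Set} → (∀ x → Dec (P x)) → ℕ
count {zero}  P? = 0
count {suc n} P? = indℕ (P? zero) ℕ.+ count (P? ∘ suc)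

count-filter : ∀ {A : Set} {P : A → Set} (P? : ∀ x → Dec (P x)) {n} (f : Fin n → A) →
               length (filter P? (List.tabulate f)) ≡ count (λ x → P? (f x))
count-filter P? {zero}  f = refl
count-filter P? {suc n} f with P? (f zero)
... | yes _ = cong suc (count-filter P? (f ∘ suc))
... | no _  = count-filter P? (f ∘ suc)

count-cong : ∀ {n} {P Q : Fin n → Set} (P? : ∀ x → Dec (P x)) (Q? : ∀ x → Dec (Q x)) →
             (∀ x → P x → Q x) → (∀ x → Q x → P x) → count P? ≡ count Q?
count-cong {zero}  P? Q? P→Q Q→P = refl
count-cong {suc n} P? Q? P→Q Q→P =
  cong₂ ℕ._+_ (indℕ-cong (P? zero) (Q? zero) (P→Q zero) (Q→P zero))
              (count-cong (P? ∘ suc) (Q? ∘ suc) (P→Q ∘ suc) (Q→P ∘ suc))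

count-≤ : ∀ {n} {P : Fin n → Set} (P? : ∀ x → Dec (P x)) → count P? ℕ.≤ n
count-≤ {zero}  P? = z≤n
count-≤ {suc n} P? with P? zero
... | yes _ = s≤s (count-≤ (P? ∘ suc))
... | no _  = ℕP.m≤n⇒m≤1+n (count-≤ (P? ∘ suc))

count-none : ∀ {n} {P : Fin n → Set} (P? : ∀ x → Dec (P x)) → (∀ x → ¬ P x) → count P? ≡ 0
count-none {zero}  P? none = refl
count-none {suc n} P? none with P? zero
... | yes p = ⊥-elim (none zero p)
... | no _  = count-none (P? ∘ suc) (none ∘ suc)

count-none⁻ : ∀ {n} {P : Fin n → Set} (P? : ∀ x → Dec (P x)) → count P? ≡ 0 → ∀ x → ¬ P x
count-none⁻ {suc n} P? count≡0 x p with P? zero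
count-none⁻ {suc n} P? ()      x       p | yes _
count-none⁻ {suc n} P? count≡0 zero    p | no ¬p0 = ¬p0 p
count-none⁻ {suc n} P? count≡0 (suc x) p | no _   = count-none⁻ (P? ∘ suc) count≡0 x p

count-all : ∀ {n} {P : Fin n → Set} (P? : ∀ x → Dec (P x)) → (∀ x → P x) → count P? ≡ n
count-all {zero}  P? all = refl
count-all {suc n} P? all with P? zero
... | yes _  = cong suc (count-all (P? ∘ suc) (all ∘ suc))
... | no ¬p0 = ⊥-elim (¬p0 (all zero))

count-unique : ∀ {n} {P : Fin n → Set} (P? : ∀ x → Dec (P x)) (w : Fin n) → P w → (∀ x → P x → x ≡ w) →
               count P? ≡ 1
count-unique {suc n} P? zero pw unique with P? zero
... | yes _  = cong suc (count-none (P? ∘ suc) (λ x p → 0≢1+n (sym (unique (suc x) p))))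
  where
  0≢1+n : ∀ {x : Fin n} → ¬ zero ≡ suc x
  0≢1+n ()
... | no ¬p0 = ⊥-elim (¬p0 pw)
count-unique {suc n} P? (suc w) pw unique with P? zero
... | yes p0 = ⊥-elim (0≢1+n (unique zero p0))
  where
  0≢1+n : ¬ zero ≡ suc w
  0≢1+n ()
... | no _   = count-unique (P? ∘ suc) w pw (λ x p → FP.suc-injective (unique (suc x) p))

count-split : ∀ {n} {P Q : Fin n → Set} (P? : ∀ x → Dec (P x)) (Q? : ∀ x → Dec (Q x)) →
              count P? ≡ count (λ x → P? x ×-dec ¬? (Q? x)) ℕ.+ count (λ x → P? x ×-dec Q? x)
count-split {zero}  P? Q? = refl
count-split {suc n} P? Q? with P? zero | Q? zero
... | yes _ | yes _ = trans (cong suc (count-split (P? ∘ suc) (Q? ∘ suc))) (sym (ℕP.+-suc _ _))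
... | yes _ | no _  = cong suc (count-split (P? ∘ suc) (Q? ∘ suc))
... | no _  | yes _ = count-split (P? ∘ suc) (Q? ∘ suc)
... | no _  | no _  = count-split (P? ∘ suc) (Q? ∘ suc)

-- Colourings constant on the classes of an equivalence relation on Fin n

RelFin : ℕ → Set₁
RelFin n = Fin n → Fin n → Set

tailRel : ∀ {n} → RelFin (suc n) → RelFin n
tailRel R u v = R (suc u) (suc v)

tailEquivalence : ∀ {n} {R : RelFin (suc n)} → IsEquivalence R → IsEquivalence (tailRel R)
tailEquivalence eq = record { refl = ≈-refl ; sym = ≈-sym ; trans = ≈-trans }
  where open IsEquivalence eq renaming (refl to ≈-refl; sym to ≈-sym; trans to ≈-trans)

ConstantOn : ∀ {n k} → RelFin n → Colouring n k → Set
ConstantOn R c = ∀ u v → R u v → c u ≡ c v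

constantOn? : ∀ {n k} {R : RelFin n} (R? : ∀ u v → Dec (R u v)) (c : Colouring n k) → Dec (ConstantOn R c)
constantOn? R? c = FP.all? (λ u → FP.all? (λ v → R? u v →-dec (c u FP.≟ c v)))

IsLeast : ∀ {n} → RelFin n → Fin n → Set
IsLeast R v = ∀ u → R u v → ¬ (u Fin.< v)

isLeast? : ∀ {n} {R : RelFin n} (R? : ∀ u v → Dec (R u v)) (v : Fin n) → Dec (IsLeast R v)
isLeast? R? v = FP.all? (λ u → R? u v →-dec ¬? (u FP.<? v))

count-isLeast-suc : ∀ {n} {R : RelFin (suc n)} (R? : ∀ u v → Dec (R u v)) →
  count (isLeast? R?) ≡ suc (count (λ v → isLeast? {R = tailRel R} (λ u v → R? (suc u) (suc v)) v ×-dec ¬? (R? zero (suc v))))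
count-isLeast-suc {n} {R} R? = cong₂ ℕ._+_
  (indℕ-cong (isLeast? R? zero) (yes zero-least) (λ _ → zero-least) (λ _ → zero-least))
  (count-cong (isLeast? R? ∘ suc) (λ v → isLeast? {R = tailRel R} (λ u v → R? (suc u) (suc v)) v ×-dec ¬? (R? zero (suc v)))
              (λ v least → (λ u r u<v → least (suc u) r (s≤s u<v)) , (λ r → least zero r (s≤s z≤n)))
                  (λ { v (least , ¬r) zero r _ → ¬r r ; v (least , ¬r) (suc u) r u<v → least u r (ℕP.≤-pred u<v) }))
  where
  zero-least : IsLeast R zero
  zero-least u r ()

module _ {n} {R : RelFin (suc n)} (R? : ∀ u v → Dec (R u v)) (eq : IsEquivalence R) where
  open IsEquivalence eq using () renaming (sym to ≈-sym; trans to ≈-trans)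

  private
    R⁺? : ∀ u v → Dec (tailRel R u v)
    R⁺? u v = R? (suc u) (suc v)

  -- if 0 is related to a later vertex, its class has a unique least element among 1, …, n
  count-isLeast-joined : ∀ v₀ → R zero (suc v₀) → count (isLeast? R?) ≡ count (isLeast? R⁺?)
  count-isLeast-joined v₀ r₀ = begin
      count (isLeast? R?)
    ≡⟨ count-isLeast-suc R? ⟩
      suc (count (λ v → isLeast? R⁺? v ×-dec ¬? (R? zero (suc v))))
    ≡⟨ ℕP.+-comm 1 _ ⟩
      count (λ v → isLeast? R⁺? v ×-dec ¬? (R? zero (suc v))) ℕ.+ 1
    ≡⟨ cong (count (λ v → isLeast? R⁺? v ×-dec ¬? (R? zero (suc v))) ℕ.+_)
            (sym (count-unique (λ v → isLeast? R⁺? v ×-dec R? zero (suc v)) w (w-least , r-w) unique)) ⟩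
      count (λ v → isLeast? R⁺? v ×-dec ¬? (R? zero (suc v))) ℕ.+ count (λ v → isLeast? R⁺? v ×-dec R? zero (suc v))
    ≡⟨ sym (count-split (isLeast? R⁺?) (λ v → R? zero (suc v))) ⟩
      count (isLeast? R⁺?) ∎
    where
    open ≡-Reasoning
    smallest : ∃ λ w → ¬ ¬ R zero (suc w) × (∀ (u : Fin.Fin′ w) → ¬ R zero (suc (Fin.inject u)))
    smallest = FP.¬∀⟶∃¬-smallest n (λ v → ¬ R zero (suc v)) (λ v → ¬? (R? zero (suc v))) (λ h → h v₀ r₀)
    w : Fin n
    w = proj₁ smallest
    r-w : R zero (suc w)
    r-w with R? zero (suc w)
    ... | yes r  = r
    ... | no ¬r  = ⊥-elim (proj₁ (proj₂ smallest) ¬r)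
    w-least : IsLeast (tailRel R) w
    w-least u r u<w = proj₂ (proj₂ smallest) (Fin.fromℕ< u<w)
      (subst (λ z → R zero (suc z)) (sym inject-fromℕ<) (≈-trans r-w (≈-sym r)))
      where
      inject-fromℕ< : Fin.inject (Fin.fromℕ< u<w) ≡ u
      inject-fromℕ< = FP.toℕ-injective (trans (FP.toℕ-inject (Fin.fromℕ< u<w)) (FP.toℕ-fromℕ< u<w))
    unique : ∀ x → IsLeast (tailRel R) x × R zero (suc x) → x ≡ w
    unique x (x-least , r-x) with FP.<-cmp x w
    ... | tri< x<w _ _ = ⊥-elim (w-least x (≈-trans (≈-sym r-x) r-w) x<w)
    ... | tri≈ _ x≡w _ = x≡w
    ... | tri> _ _ w<x = ⊥-elim (x-least w (≈-trans (≈-sym r-w) r-x) w<x)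

  count-isLeast-isolated : (∀ v → ¬ R zero (suc v)) → count (isLeast? R?) ≡ suc (count (isLeast? R⁺?))
  count-isLeast-isolated isolated = trans (count-isLeast-suc R?)
    (cong suc (count-cong (λ v → isLeast? R⁺? v ×-dec ¬? (R? zero (suc v))) (isLeast? R⁺?) (λ _ → proj₁) (λ v least → least , isolated v)))

  -- extending a colouring c of 1, …, n by the colour x of vertex 0: if 0 is related to
  -- v₀ the colour x is forced to be c v₀, otherwise it is free
  constantOn-cons-joined : ∀ {k} v₀ → R zero (suc v₀) → (x : Fin k) (c : Colouring n k) →
    ind (constantOn? R? (x VF.∷ c)) ≡ ind (constantOn? R⁺? c) * ind (x FP.≟ c v₀)
  constantOn-cons-joined v₀ r₀ x c =
    trans (ind-cong (constantOn? R? (x VF.∷ c)) (constantOn? R⁺? c ×-dec (x FP.≟ c v₀))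
                    (λ const → (λ u v → const (suc u) (suc v)) , const zero (suc v₀) r₀) extend)
          (sym (ind-× (constantOn? R⁺? c) (x FP.≟ c v₀)))
    where
    extend : ConstantOn (tailRel R) c × x ≡ c v₀ → ConstantOn R (x VF.∷ c)
    extend (const , x≡cv₀) zero    zero    _ = refl
    extend (const , x≡cv₀) zero    (suc v) r = trans x≡cv₀ (const v₀ v (≈-trans (≈-sym r₀) r))
    extend (const , x≡cv₀) (suc u) zero    r = trans (const u v₀ (≈-trans r r₀)) (sym x≡cv₀)
    extend (const , x≡cv₀) (suc u) (suc v) r = const u v r

  constantOn-cons-isolated : ∀ {k} → (∀ v → ¬ R zero (suc v)) → (x : Fin k) (c : Colouring n k) →
    ind (constantOn? R? (x VF.∷ c)) ≡ ind (constantOn? R⁺? c)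
  constantOn-cons-isolated isolated x c =
    ind-cong (constantOn? R? (x VF.∷ c)) (constantOn? R⁺? c) (λ const u v → const (suc u) (suc v)) extend
    where
    extend : ConstantOn (tailRel R) c → ConstantOn R (x VF.∷ c)
    extend const zero    zero    _ = refl
    extend const zero    (suc v) r = ⊥-elim (isolated v r)
    extend const (suc u) zero    r = ⊥-elim (isolated u (≈-sym r))
    extend const (suc u) (suc v) r = const u v r

-- colourings constant on the classes are colourings of the classes, and the least
-- elements enumerate the classes:  #{c : [n] → [k] constant on classes} = k^#classes
count-constantOn : ∀ n k {R : RelFin n} (R? : ∀ u v → Dec (R u v)) → IsEquivalence R →
                   Σc n k (λ c → ind (constantOn? R? c)) ≡ (+ k) ℤ.^ count (isLeast? R?)
count-constantOn zero    k R? eq =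
  trans (Σc-zero k (λ c → ind (constantOn? R? c)) (λ c c' _ → ind-cong (constantOn? R? c) (constantOn? R? c') (λ _ ()) (λ _ ())) noColours)
        (ind-yes (constantOn? R? (noColours {k})) (λ ()))
count-constantOn (suc n) k {R} R? eq with FP.any? (λ v → R? zero (suc v))
... | yes (v₀ , r₀) = begin
    Σc (suc n) k (λ c → ind (constantOn? R? c))
  ≡⟨ Σc-suc n k _ ⟩
    sum (λ x → Σc n k (λ c → ind (constantOn? R? (x VF.∷ c))))
  ≡⟨ sum-cong-≗ {k} (λ x → ΣL-cong (allMaps n k) (constantOn-cons-joined R? eq v₀ r₀ x)) ⟩
    sum (λ x → Σc n k (λ c → ind (constantOn? R⁺? c) * ind (x FP.≟ c v₀)))
  ≡⟨ sym (ΣL-sum (allMaps n k) (λ c x → ind (constantOn? R⁺? c) * ind (x FP.≟ c v₀))) ⟩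
    Σc n k (λ c → sum (λ x → ind (constantOn? R⁺? c) * ind (x FP.≟ c v₀)))
  ≡⟨ ΣL-cong (allMaps n k) (λ c → trans (sum-*ˡ {k} (ind (constantOn? R⁺? c)) _)
       (trans (cong (ind (constantOn? R⁺? c) *_) (sum-delta (c v₀))) (ℤP.*-identityʳ _))) ⟩
    Σc n k (λ c → ind (constantOn? R⁺? c))
  ≡⟨ count-constantOn n k R⁺? (tailEquivalence eq) ⟩
    (+ k) ℤ.^ count (isLeast? R⁺?)
  ≡⟨ cong ((+ k) ℤ.^_) (sym (count-isLeast-joined R? eq v₀ r₀)) ⟩
    (+ k) ℤ.^ count (isLeast? R?) ∎
  where
  open ≡-Reasoning
  R⁺? : ∀ u v → Dec (tailRel R u v)
  R⁺? u v = R? (suc u) (suc v)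
... | no ¬joined = begin
    Σc (suc n) k (λ c → ind (constantOn? R? c))
  ≡⟨ Σc-suc n k _ ⟩
    sum (λ x → Σc n k (λ c → ind (constantOn? R? (x VF.∷ c))))
  ≡⟨ sum-cong-≗ {k} (λ x → ΣL-cong (allMaps n k) (constantOn-cons-isolated R? eq isolated x)) ⟩
    sum {k} (λ _ → Σc n k (λ c → ind (constantOn? R⁺? c)))
  ≡⟨ sum-const k _ ⟩
    + k * Σc n k (λ c → ind (constantOn? R⁺? c))
  ≡⟨ cong (+ k *_) (count-constantOn n k R⁺? (tailEquivalence eq)) ⟩
    (+ k) ℤ.^ suc (count (isLeast? R⁺?))
  ≡⟨ cong ((+ k) ℤ.^_) (sym (count-isLeast-isolated R? eq isolated)) ⟩
    (+ k) ℤ.^ count (isLeast? R?) ∎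
  where
  open ≡-Reasoning
  R⁺? : ∀ u v → Dec (tailRel R u v)
  R⁺? u v = R? (suc u) (suc v)
  isolated : ∀ v → ¬ R zero (suc v)
  isolated v r = ¬joined (v , r)

-- Connected components of ([n], {E j | j ∈ T})

module Components {n m : ℕ} (E : Fin m → Subset n) (T : Subset m) where

  Closed : (Fin n → Set) → Set
  Closed Q = ∀ j → j ∈ T → ∀ w → w ∈ E j → Q w → ∀ x → x ∈ E j → Q x

  private
    step : Subset n → Fin m → Subset n → Subset n
    step R j acc = if does (j ∈? T) ∧ does (nonempty? (E j ∩ R)) then E j ∪ acc else acc

    fold-⊇ : ∀ R L {x} → x ∈ R → x ∈ List.foldr (step R) R L
    fold-⊇ R []      x∈R = x∈R
    fold-⊇ R (j ∷ L) x∈R with j ∈? T | nonempty? (E j ∩ R)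
    ... | yes _ | yes _ = x∈p∪q⁺ (inj₂ (fold-⊇ R L x∈R))
    ... | yes _ | no _  = fold-⊇ R L x∈R
    ... | no _  | _     = fold-⊇ R L x∈R

    fold-edge : ∀ R L j → j ∈ₗ L → j ∈ T → Nonempty (E j ∩ R) → ∀ {x} → x ∈ E j →
                x ∈ List.foldr (step R) R L
    fold-edge R (i ∷ L) j (here refl) j∈T meets x∈E with j ∈? T | nonempty? (E j ∩ R)
    ... | yes _  | yes _     = x∈p∪q⁺ (inj₁ x∈E)
    ... | yes _  | no ¬meets = ⊥-elim (¬meets meets)
    ... | no j∉T | _         = ⊥-elim (j∉T j∈T)
    fold-edge R (i ∷ L) j (there j∈L) j∈T meets x∈E with i ∈? T | nonempty? (E i ∩ R)
    ... | yes _ | yes _ = x∈p∪q⁺ (inj₂ (fold-edge R L j j∈L j∈T meets x∈E))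
    ... | yes _ | no _  = fold-edge R L j j∈L j∈T meets x∈E
    ... | no _  | _     = fold-edge R L j j∈L j∈T meets x∈E

    fold-source : ∀ R L {x} → x ∈ List.foldr (step R) R L →
                  x ∈ R ⊎ ∃ λ j → j ∈ T × Nonempty (E j ∩ R) × x ∈ E j
    fold-source R []      x∈ = inj₁ x∈
    fold-source R (j ∷ L) x∈ with j ∈? T | nonempty? (E j ∩ R)
    ... | yes j∈T | yes meets with x∈p∪q⁻ (E j) _ x∈
    ...   | inj₁ x∈E = inj₂ (j , j∈T , meets , x∈E)
    ...   | inj₂ x∈  = fold-source R L x∈
    fold-source R (j ∷ L) x∈ | yes _ | no _ = fold-source R L x∈
    fold-source R (j ∷ L) x∈ | no _  | _    = fold-source R L x∈

  expand-⊇ : ∀ R → R ⊆ expand E T R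
  expand-⊇ R = fold-⊇ R (List.allFin m)

  expand-edge : ∀ R j → j ∈ T → Nonempty (E j ∩ R) → E j ⊆ expand E T R
  expand-edge R j = fold-edge R (List.allFin m) j (∈-allFin j)

  expand-source : ∀ R {x} → x ∈ expand E T R → x ∈ R ⊎ ∃ λ j → j ∈ T × Nonempty (E j ∩ R) × x ∈ E j
  expand-source R = fold-source R (List.allFin m)

  reach : Fin n → ℕ → Subset n
  reach v t = iter t (expand E T) ⁅ v ⁆

  reach-least : ∀ (Q : Fin n → Set) v → Closed Q → Q v → ∀ t {x} → x ∈ reach v t → Q x
  reach-least Q v closed Qv zero    x∈ = subst Q (sym (x∈⁅y⁆⇒x≡y v x∈)) Qv
  reach-least Q v closed Qv (suc t) x∈ with expand-source (reach v t) x∈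
  ... | inj₁ x∈reach = reach-least Q v closed Qv t x∈reach
  ... | inj₂ (j , j∈T , (w , w∈E∩reach) , x∈E) =
    closed j j∈T w (proj₁ (x∈p∩q⁻ (E j) _ w∈E∩reach))
           (reach-least Q v closed Qv t (proj₂ (x∈p∩q⁻ (E j) _ w∈E∩reach))) _ x∈E

  reach-∋ : ∀ v t → v ∈ reach v t
  reach-∋ v zero    = x∈⁅x⁆ v
  reach-∋ v (suc t) = expand-⊇ _ (reach-∋ v t)

  stationary-or-large : ∀ v t → (expand E T (reach v t) ⊆ reach v t) ⊎ suc t ℕ.≤ ∣ reach v t ∣
  stationary-or-large v zero = inj₂ (ℕP.≤-reflexive (sym (∣⁅x⁆∣≡1 v)))
  stationary-or-large v (suc t) with stationary-or-large v t
  ... | inj₁ stat = inj₁ (subst (λ S → expand E T S ⊆ S) (sym (⊆-antisym stat (expand-⊇ _))) stat)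
  ... | inj₂ large with expand E T (reach v t) ⊆? reach v t
  ...   | yes stat = inj₁ (subst (λ S → expand E T S ⊆ S) (sym (⊆-antisym stat (expand-⊇ _))) stat)
  ...   | no ¬stat = inj₂ (ℕP.≤-trans (s≤s large) (p⊂q⇒∣p∣<∣q∣ (expand-⊇ _ , new-vertex)))
    where
    new-vertex : ∃ λ x → x ∈ expand E T (reach v t) × x ∉ reach v t
    new-vertex with FP.¬∀⟶∃¬ n (λ x → x ∈ expand E T (reach v t) → x ∈ reach v t)
                      (λ x → (x ∈? expand E T (reach v t)) →-dec (x ∈? reach v t)) (λ h → ¬stat (λ {x} → h x))
    ... | x , ¬x⊆ with x ∈? expand E T (reach v t)
    ...   | yes x∈ = x , x∈ , (λ x∈reach → ¬x⊆ (λ _ → x∈reach))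
    ...   | no x∉  = ⊥-elim (¬x⊆ (λ x∈ → ⊥-elim (x∉ x∈)))

  comp : Fin n → Subset n
  comp = component E T

  comp-stationary : ∀ v {x} → x ∈ expand E T (comp v) → x ∈ comp v
  comp-stationary v with stationary-or-large v n
  ... | inj₁ stat  = stat
  ... | inj₂ large = ⊥-elim (ℕP.<-irrefl refl (ℕP.≤-trans large (∣p∣≤n (comp v))))

  comp-closed : ∀ v → Closed (λ x → x ∈ comp v)
  comp-closed v j j∈T w w∈E w∈comp x x∈E =
    comp-stationary v (expand-edge (comp v) j j∈T (w , x∈p∩q⁺ (w∈E , w∈comp)) x∈E)

  comp-∋ : ∀ v → v ∈ comp v
  comp-∋ v = reach-∋ v n

  comp-least : ∀ (Q : Fin n → Set) v → Closed Q → Q v → ∀ {x} → x ∈ comp v → Q x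
  comp-least Q v closed Qv = reach-least Q v closed Qv n

  comp-equivalence : IsEquivalence (λ u v → u ∈ comp v)
  comp-equivalence = record { refl = comp-∋ _ ; sym = comp-sym ; trans = comp-trans }
    where
    comp-trans : ∀ {u v w} → u ∈ comp v → v ∈ comp w → u ∈ comp w
    comp-trans {w = w} u∈ v∈ = comp-least (λ x → x ∈ comp w) _ (comp-closed w) v∈ u∈
    comp-sym : ∀ {u v} → u ∈ comp v → v ∈ comp u
    comp-sym {u} {v} u∈ with v ∈? comp u
    ... | yes v∈ = v∈
    ... | no v∉  = ⊥-elim (comp-least (λ x → x ∉ comp u) v outside-closed v∉ u∈ (comp-∋ u))
      where
      outside-closed : Closed (λ x → x ∉ comp u)
      outside-closed j j∈T w w∈E w∉ x x∈E x∈ = w∉ (comp-closed u j j∈T x x∈E x∈ w w∈E)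

  MonoOn : ∀ {k} → Colouring n k → Set
  MonoOn c = ∀ j → j ∈ T → Monochromatic (E j) c

  monoOn? : ∀ {k} (c : Colouring n k) → Dec (MonoOn c)
  monoOn? c = FP.all? (λ j → (j ∈? T) →-dec monochromatic? (E j) c)

  monoOn-invariant : ClassInvariant MonoOn
  monoOn-invariant c c' coarser _ mono j j∈T u v u∈ v∈ = coarser u v (mono j j∈T u v u∈ v∈)

  monoOn⇔constant : ∀ {k} (c : Colouring n k) →
                    (MonoOn c → ConstantOn (λ u v → u ∈ comp v) c) × (ConstantOn (λ u v → u ∈ comp v) c → MonoOn c)
  monoOn⇔constant c = to , from
    where
    to : MonoOn c → ConstantOn (λ u v → u ∈ comp v) c
    to mono u v u∈ = comp-least (λ x → c x ≡ c v) v closed refl u∈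
      where
      closed : Closed (λ x → c x ≡ c v)
      closed j j∈T w w∈E cw≡cv x x∈E = trans (mono j j∈T x w x∈E w∈E) cw≡cv
    from : ConstantOn (λ u v → u ∈ comp v) c → MonoOn c
    from const j j∈T u v u∈E v∈E = sym (const v u (comp-closed u j j∈T u u∈E (comp-∋ u) v v∈E))

  count-monoOn : ∀ k → Σc n k (λ c → ind (monoOn? c)) ≡ (+ k) ℤ.^ numComponents E T
  count-monoOn k =
    trans (ΣL-cong (allMaps n k) (λ c → ind-cong (monoOn? c) (constantOn? (λ u v → u ∈? comp v) c)
                                                 (proj₁ (monoOn⇔constant c)) (proj₂ (monoOn⇔constant c))))
          (trans (count-constantOn n k (λ u v → u ∈? comp v) comp-equivalence)
                 (cong ((+ k) ℤ.^_) (sym (count-filter (isRepresentative? E T) (λ x → x)))))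

numComponents-≤ : ∀ {n m} (E : Fin m → Subset n) T → numComponents E T ℕ.≤ n
numComponents-≤ {n} E T =
  subst (ℕ._≤ n) (sym (count-filter (isRepresentative? E T) (λ x → x))) (count-≤ (isRepresentative? E T))

numComponents-empty : ∀ {n m} (E : Fin m → Subset n) (T : Subset m) → (∀ j → j ∉ T) → numComponents E T ≡ n
numComponents-empty {n} E T no-edge =
  trans (count-filter (isRepresentative? E T) (λ x → x)) (count-all (isRepresentative? E T) representative)
  where
  open Components E T
  representative : ∀ v → IsRepresentative E T v
  representative v u u∈ u<v =
    FP.<-irrefl (comp-least (λ x → x ≡ v) v (λ j j∈T → ⊥-elim (no-edge j j∈T)) refl u∈) u<v

allIn? : ∀ {m} (T : Subset m) {Q : Fin m → Set} (Q? : ∀ j → Dec (Q j)) → Dec (∀ j → j ∈ T → Q j)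
allIn? T Q? = FP.all? (λ j → (j ∈? T) →-dec Q? j)

binomial-step : ∀ {p} {P : Set p} (d : Dec P) q a → ind d * + (q C a) + + (q C suc a) ≡ + ((indℕ d ℕ.+ q) C suc a)
binomial-step (yes _) q a = trans (cong (_+ + (q C suc a)) (ℤP.*-identityˡ (+ (q C a)))) (sym (pascal-ℤ q a))
binomial-step (no _)  q a = refl

count-subsets : ∀ m a {Q : Fin m → Set} (Q? : ∀ j → Dec (Q j)) →
                ΣL (allSubsets m) (λ T → ind (∣ T ∣ ℕP.≟ a) * ind (allIn? T Q?)) ≡ + (count Q? C a)
count-subsets zero    zero    Q? = cong (_+ 0ℤ) (ind-yes (allIn? Vec.[] Q?) (λ ()))
count-subsets zero    (suc a) Q? = refl
count-subsets (suc m) a {Q} Q? = begin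
    ΣL (List.map (inside Vec.∷_) S ++ List.map (outside Vec.∷_) S) (F a)
  ≡⟨ trans (ΣL-++ (List.map (inside Vec.∷_) S) _ (F a))
           (cong₂ _+_ (ΣL-map (inside Vec.∷_) S (F a)) (ΣL-map (outside Vec.∷_) S (F a))) ⟩
    ΣL S (λ T → F a (inside Vec.∷ T)) + ΣL S (λ T → F a (outside Vec.∷ T))
  ≡⟨ cong (λ w → ΣL S (λ T → F a (inside Vec.∷ T)) + w) (trans (ΣL-cong S without-0) (count-subsets m a Q⁺?)) ⟩
    ΣL S (λ T → F a (inside Vec.∷ T)) + + (count Q⁺? C a)
  ≡⟨ combine a ⟩
    + (count Q? C a) ∎
  where
  open ≡-Reasoning
  S : List (Subset m)
  S = allSubsets m
  Q⁺? : ∀ j → Dec (Q (suc j))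
  Q⁺? j = Q? (suc j)
  F : ℕ → Subset (suc m) → ℤ
  F a T = ind (∣ T ∣ ℕP.≟ a) * ind (allIn? T Q?)
  without-0 : ∀ T → F a (outside Vec.∷ T) ≡ ind (∣ T ∣ ℕP.≟ a) * ind (allIn? T Q⁺?)
  without-0 T = cong (ind (∣ T ∣ ℕP.≟ a) *_)
    (ind-cong (allIn? (outside Vec.∷ T) Q?) (allIn? T Q⁺?)
              (λ all j j∈T → all (suc j) (Vec.there j∈T))
              (λ { all zero () ; all (suc j) (Vec.there j∈T) → all j j∈T }))
  with-0 : ∀ a T → F (suc a) (inside Vec.∷ T) ≡ ind (Q? zero) * (ind (∣ T ∣ ℕP.≟ a) * ind (allIn? T Q⁺?))
  with-0 a T =
    trans (cong₂ _*_ (ind-cong (suc ∣ T ∣ ℕP.≟ suc a) (∣ T ∣ ℕP.≟ a) ℕP.suc-injective (cong suc))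
                     (trans (ind-cong (allIn? (inside Vec.∷ T) Q?) (Q? zero ×-dec allIn? T Q⁺?)
                              (λ all → all zero Vec.here , λ j j∈T → all (suc j) (Vec.there j∈T))
                              (λ { (q₀ , all) zero _ → q₀ ; (q₀ , all) (suc j) (Vec.there j∈T) → all j j∈T }))
                            (sym (ind-× (Q? zero) (allIn? T Q⁺?)))))
          (swap-factors (ind (∣ T ∣ ℕP.≟ a)) (ind (Q? zero)) (ind (allIn? T Q⁺?)))
    where
    swap-factors : ∀ x y z → x * (y * z) ≡ y * (x * z)
    swap-factors = solve-∀
  combine : ∀ a → ΣL S (λ T → F a (inside Vec.∷ T)) + + (count Q⁺? C a) ≡ + (count Q? C a)
  combine zero    = cong (_+ 1ℤ) (ΣL-zero S (λ T → cong (_* ind (allIn? (inside Vec.∷ T) Q?))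
                                                        (ind-no (suc ∣ T ∣ ℕP.≟ 0) (λ ()))))
  combine (suc a) =
    trans (cong (_+ + (count Q⁺? C suc a))
                (trans (ΣL-cong S (with-0 a)) (trans (ΣL-*ˡ S (ind (Q? zero)) _)
                       (cong (ind (Q? zero) *_) (count-subsets m a Q⁺?)))))
          (binomial-step (Q? zero) (count Q⁺? ) a)

size-zero : ∀ {m} (T : Subset m) → ∣ T ∣ ≡ 0 → ∀ j → j ∉ T
size-zero (outside Vec.∷ T) size≡0 zero    ()
size-zero (outside Vec.∷ T) size≡0 (suc j) (Vec.there j∈T) = size-zero T size≡0 j j∈T
size-zero (inside Vec.∷ T)  ()     j       j∈T

-- s(0,b) = [b = n] (the definition compares b and n by ≡ᵇ)
s-zero-self : ∀ {n m} (E : Fin m → Subset n) → s E 0 n ≡ 1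
s-zero-self {n} E with n ℕ.≡ᵇ n in eq
... | true  = refl
... | false = ⊥-elim (subst Bool.T eq (ℕP.≡⇒≡ᵇ n n refl))

s-zero-other : ∀ {n m} (E : Fin m → Subset n) b → ¬ b ≡ n → s E 0 b ≡ 0
s-zero-other {n} E b b≢n with b ℕ.≡ᵇ n in eq
... | true  = ⊥-elim (b≢n (ℕP.≡ᵇ⇒≡ b n (subst Bool.T (sym eq) tt)))
... | false = refl

s-weighted-sum : ∀ {n m} (E : Fin m → Subset n) (g : ℕ → ℤ) a →
                 Σ≤ n (λ b → + s E a b * g b) ≡ ΣL (allSubsets m) (λ T → ind (∣ T ∣ ℕP.≟ a) * g (numComponents E T))
s-weighted-sum {n} {m} E g zero = begin
    Σ≤ n (λ b → + s E 0 b * g b)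
  ≡⟨ Σ≤-single n n _ ℕP.≤-refl (λ b b≢n → cong (λ w → + w * g b) (s-zero-other E b b≢n)) ⟩
    + s E 0 n * g n
  ≡⟨ trans (cong (λ w → + w * g n) (s-zero-self E)) (ℤP.*-identityˡ (g n)) ⟩
    g n
  ≡⟨ sym (trans (ΣL-*ˡ (allSubsets m) (g n) _) (trans (cong (g n *_) (count-subsets m 0 everything?))
                                                       (ℤP.*-identityʳ (g n)))) ⟩
    ΣL (allSubsets m) (λ T → g n * (ind (∣ T ∣ ℕP.≟ 0) * ind (allIn? T everything?)))
  ≡⟨ ΣL-cong (allSubsets m) empty-only ⟩
    ΣL (allSubsets m) (λ T → ind (∣ T ∣ ℕP.≟ 0) * g (numComponents E T)) ∎
  where
  open ≡-Reasoning
  everything? : ∀ (j : Fin m) → Dec ⊤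
  everything? j = yes tt
  empty-only : ∀ T → g n * (ind (∣ T ∣ ℕP.≟ 0) * ind (allIn? T everything?)) ≡ ind (∣ T ∣ ℕP.≟ 0) * g (numComponents E T)
  empty-only T with ∣ T ∣ ℕP.≟ 0
  ... | yes size≡0 =
    trans (cong (λ w → g n * (1ℤ * w)) (ind-yes (allIn? T everything?) (λ _ _ → tt)))
          (trans (ℤP.*-identityʳ (g n))
                 (trans (cong g (sym (numComponents-empty E T (size-zero T size≡0)))) (sym (ℤP.*-identityˡ _))))
  ... | no _ = ℤP.*-zeroʳ (g n)
s-weighted-sum {n} {m} E g (suc a) = begin
    Σ≤ n (λ b → + s E (suc a) b * g b)
  ≡⟨ Σ≤-cong n (λ b _ → trans (cong (_* g b) (length-filter _ S))
                              (trans (ΣL-*ʳ S (g b) _) (ΣL-cong S (λ T → split-weight T b)))) ⟩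
    Σ≤ n (λ b → ΣL S (λ T → ind (∣ T ∣ ℕP.≟ suc a) * (ind (numComponents E T ℕP.≟ b) * g b)))
  ≡⟨ sym (ΣL-Σ≤ S n _) ⟩
    ΣL S (λ T → Σ≤ n (λ b → ind (∣ T ∣ ℕP.≟ suc a) * (ind (numComponents E T ℕP.≟ b) * g b)))
  ≡⟨ ΣL-cong S (λ T → trans (Σ≤-*ˡ n (ind (∣ T ∣ ℕP.≟ suc a)) _)
                            (cong (ind (∣ T ∣ ℕP.≟ suc a) *_) (Σ≤-delta n (numComponents E T) g (numComponents-≤ E T)))) ⟩
    ΣL S (λ T → ind (∣ T ∣ ℕP.≟ suc a) * g (numComponents E T)) ∎
  where
  open ≡-Reasoning
  S : List (Subset m)
  S = allSubsets m
  split-weight : ∀ T b → ind ((∣ T ∣ ℕP.≟ suc a) ×-dec (numComponents E T ℕP.≟ b)) * g b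
                       ≡ ind (∣ T ∣ ℕP.≟ suc a) * (ind (numComponents E T ℕP.≟ b) * g b)
  split-weight T b = trans (cong (_* g b) (sym (ind-× (∣ T ∣ ℕP.≟ suc a) (numComponents E T ℕP.≟ b))))
                           (ℤP.*-assoc (ind (∣ T ∣ ℕP.≟ suc a)) (ind (numComponents E T ℕP.≟ b)) (g b))

-- Pigeonhole bounds

pigeonhole-avoiding : ∀ n {p} (F : Subset n) (g : Fin p → Fin n) → Injective _≡_ _≡_ g →
                      (∀ x → g x ∉ F) → p ℕ.+ ∣ F ∣ ℕ.≤ n
pigeonhole-avoiding zero    {zero}  Vec.[] g inj avoid = z≤n
pigeonhole-avoiding zero    {suc p} Vec.[] g inj avoid with g zero
... | ()
pigeonhole-avoiding (suc n) {p} (inside Vec.∷ F) g inj avoid =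
  subst (ℕ._≤ suc n) (sym (ℕP.+-suc p ∣ F ∣))
        (s≤s (pigeonhole-avoiding n F (λ x → punchOut (0≢g x)) (λ e → inj (below-zero e)) avoid-tail))
  where
  0≢g : ∀ x → ¬ zero ≡ g x
  0≢g x 0≡gx = avoid x (subst (_∈ inside Vec.∷ F) 0≡gx Vec.here)
  below-zero : ∀ {x y} → punchOut (0≢g x) ≡ punchOut (0≢g y) → g x ≡ g y
  below-zero = FP.punchOut-injective (0≢g _) (0≢g _)
  avoid-tail : ∀ x → punchOut (0≢g x) ∉ F
  avoid-tail x ∈F = avoid x (subst (_∈ inside Vec.∷ F) (FP.punchIn-punchOut (0≢g x)) (Vec.there ∈F))
pigeonhole-avoiding (suc n) {p} (outside Vec.∷ F) g inj avoid with FP.any? (λ x → g x FP.≟ zero)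
... | no ¬hits0 =
  ℕP.m≤n⇒m≤1+n (pigeonhole-avoiding n F (λ x → punchOut (0≢g x))
                                        (λ e → inj (FP.punchOut-injective (0≢g _) (0≢g _) e)) avoid-tail)
  where
  0≢g : ∀ x → ¬ zero ≡ g x
  0≢g x 0≡gx = ¬hits0 (x , sym 0≡gx)
  avoid-tail : ∀ x → punchOut (0≢g x) ∉ F
  avoid-tail x ∈F = avoid x (subst (_∈ outside Vec.∷ F) (FP.punchIn-punchOut (0≢g x)) (Vec.there ∈F))
... | yes (x₀ , gx₀≡0) = without-x₀ g inj avoid x₀ gx₀≡0
  where
  without-x₀ : ∀ {p} (g : Fin p → Fin (suc n)) → Injective _≡_ _≡_ g → (∀ x → g x ∉ outside Vec.∷ F) →
               (x₀ : Fin p) → g x₀ ≡ zero → p ℕ.+ ∣ F ∣ ℕ.≤ suc n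
  without-x₀ {suc p} g inj avoid x₀ gx₀≡0 =
    s≤s (pigeonhole-avoiding n F (λ y → punchOut (0≢g y))
                             (λ e → FP.punchIn-injective x₀ _ _ (inj (FP.punchOut-injective (0≢g _) (0≢g _) e)))
                             avoid-tail)
    where
    0≢g : ∀ y → ¬ zero ≡ g (punchIn x₀ y)
    0≢g y 0≡g = FP.punchInᵢ≢i x₀ y (inj (trans (sym 0≡g) (sym gx₀≡0)))
    avoid-tail : ∀ y → punchOut (0≢g y) ∉ F
    avoid-tail y ∈F = avoid (punchIn x₀ y) (subst (_∈ outside Vec.∷ F) (FP.punchIn-punchOut (0≢g y)) (Vec.there ∈F))

pigeonhole-meeting-once : ∀ n {p} (F : Subset n) (g : Fin p → Fin n) → Injective _≡_ _≡_ g →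
                          (∀ x y → g x ∈ F → g y ∈ F → x ≡ y) → p ℕ.+ ∣ F ∣ ℕ.≤ suc n
pigeonhole-meeting-once n {p} F g inj once with FP.any? (λ x → g x ∈? F)
... | no ¬meets = ℕP.m≤n⇒m≤1+n (pigeonhole-avoiding n F g inj (λ x ∈F → ¬meets (x , ∈F)))
... | yes (x₀ , gx₀∈F) = without-x₀ g inj once x₀ gx₀∈F
  where
  without-x₀ : ∀ {p} (g : Fin p → Fin n) → Injective _≡_ _≡_ g → (∀ x y → g x ∈ F → g y ∈ F → x ≡ y) →
               (x₀ : Fin p) → g x₀ ∈ F → p ℕ.+ ∣ F ∣ ℕ.≤ suc n
  without-x₀ {suc p} g inj once x₀ gx₀∈F =
    s≤s (pigeonhole-avoiding n F (g ∘ punchIn x₀) (λ e → FP.punchIn-injective x₀ _ _ (inj e))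
                             (λ y ∈F → FP.punchInᵢ≢i x₀ y (once _ _ ∈F gx₀∈F)))

binomial-truncate : ∀ n t (z : ℕ → ℤ) → (∀ i → n ℕ.< i → z i ≡ 0ℤ) →
                    binomial z t 0 ≡ Σ≤ n (λ i → z i * + (t C i))
binomial-truncate n t z z-vanishes =
  trans (sym (Σ≤-vanishing-tail t (t ℕ.+ n) _ (ℕP.m≤m+n t n) beyond-t))
        (trans (Σ≤-vanishing-tail n (t ℕ.+ n) _ (ℕP.m≤n+m n t) beyond-n)
               (Σ≤-cong n (λ i _ → ℤP.*-comm (+ (t C i)) (z i))))
  where
  beyond-t : ∀ i → t ℕ.< i → + (t C i) * z i ≡ 0ℤ
  beyond-t i t<i = trans (cong (λ w → + w * z i) (k>n⇒nCk≡0 t<i)) (ℤP.*-zeroˡ (z i))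
  beyond-n : ∀ i → n ℕ.< i → + (t C i) * z i ≡ 0ℤ
  beyond-n i n<i = trans (cong (+ (t C i) *_) (z-vanishes i n<i)) (ℤP.*-zeroʳ (+ (t C i)))

coordinates-unique : ∀ n (f g : ℕ → ℤ) → (∀ t → Σ≤ n (λ i → f i * + (t C i)) ≡ Σ≤ n (λ i → g i * + (t C i))) →
                     ∀ i → i ℕ.≤ n → f i ≡ g i
coordinates-unique n f g same i i≤n =
  trans (sym (mask-≤ f i≤n))
        (trans (binomial-injective (mask f) (mask g) transforms-agree i) (mask-≤ g i≤n))
  where
  mask : (ℕ → ℤ) → ℕ → ℤ
  mask h i = ind (i ℕP.≤? n) * h i
  mask-≤ : ∀ h {i} → i ℕ.≤ n → mask h i ≡ h i
  mask-≤ h {i} i≤n = trans (cong (_* h i) (ind-yes (i ℕP.≤? n) i≤n)) (ℤP.*-identityˡ (h i))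
  mask-> : ∀ h i → n ℕ.< i → mask h i ≡ 0ℤ
  mask-> h i n<i = trans (cong (_* h i) (ind-no (i ℕP.≤? n) (ℕP.<⇒≱ n<i))) (ℤP.*-zeroˡ (h i))
  unmask : ∀ h t → Σ≤ n (λ i → mask h i * + (t C i)) ≡ Σ≤ n (λ i → h i * + (t C i))
  unmask h t = Σ≤-cong n (λ i i≤n → cong (_* + (t C i)) (mask-≤ h i≤n))
  transforms-agree : ∀ t → binomial (mask f) t 0 ≡ binomial (mask g) t 0
  transforms-agree t =
    trans (binomial-truncate n t (mask f) (mask-> f))
      (trans (unmask f t) (trans (same t)
        (trans (sym (unmask g t)) (sym (binomial-truncate n t (mask g) (mask-> g))))))

colour-witness : ∀ {n k} i (c : Colouring n k) → UsesColours i c → Fin i → Fin n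
colour-witness i c uses x = proj₁ (uses x)

witness-colours-distinct : ∀ {n k} i (c : Colouring n k) (uses : UsesColours i c) {x y : Fin i} →
                           c (colour-witness i c uses x) ≡ c (colour-witness i c uses y) → x ≡ y
witness-colours-distinct i c uses {x} {y} e = FP.toℕ-injective (ℕP.suc-injective (ℕP.suc-injective
  (trans (sym (proj₂ (uses x))) (trans (cong toℕ e) (proj₂ (uses y))))))

colour-witness-injective : ∀ {n k} i (c : Colouring n k) (uses : UsesColours i c) →
                           Injective _≡_ _≡_ (colour-witness i c uses)
colour-witness-injective i c uses e = witness-colours-distinct i c uses (cong c e)

uses-≤ : ∀ {n k} i (c : Colouring n k) → UsesColours i c → i ℕ.≤ n
uses-≤ i c uses = FP.injective⇒≤ (colour-witness-injective i c uses)

-- a monochromatic set F contains at most one witness, so  i + |F| ≤ n + 1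
uses-monochromatic : ∀ {n k} i (c : Colouring n k) → UsesColours i c → (F : Subset n) →
                     Monochromatic F c → i ℕ.+ ∣ F ∣ ℕ.≤ suc n
uses-monochromatic {n} i c uses F mono =
  pigeonhole-meeting-once n F (colour-witness i c uses) (colour-witness-injective i c uses)
    (λ x y x∈F y∈F → witness-colours-distinct i c uses (mono _ _ x∈F y∈F))

uses-proper : ∀ {n m k} (E : Fin m → Subset n) l → (∀ j → l ℕ.≤ ∣ E j ∣) → ∀ i (c : Colouring n k) →
              n ∸ l ℕ.+ 2 ℕ.≤ i → UsesColours i c → Proper E c
uses-proper {n} E l l≤E i c i-large uses j mono =
  ℕP.<-irrefl refl (subst (ℕ._≤ suc n) (ℕP.+-comm n 2) (begin
    n ℕ.+ 2                  ≤⟨ ℕP.+-monoˡ-≤ 2 (ℕP.m≤n+m∸n n l) ⟩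
    l ℕ.+ (n ∸ l) ℕ.+ 2      ≡⟨ ℕP.+-assoc l (n ∸ l) 2 ⟩
    l ℕ.+ (n ∸ l ℕ.+ 2)      ≤⟨ ℕP.+-mono-≤ (l≤E j) i-large ⟩
    ∣ E j ∣ ℕ.+ i            ≡⟨ ℕP.+-comm ∣ E j ∣ i ⟩
    i ℕ.+ ∣ E j ∣            ≤⟨ uses-monochromatic i c uses (E j) mono ⟩
    suc n                    ∎))
  where open ℕP.≤-Reasoning

module Hypergraph {n m : ℕ} (E : Fin m → Subset n) where

  open Components E using (MonoOn; monoOn?; monoOn-invariant; count-monoOn)

  proper-invariant : ClassInvariant (λ {k} c → Proper {n} {m} {k} E c)
  proper-invariant c c' _ coarser proper j mono = proper j (λ u v u∈ v∈ → coarser u v (mono u v u∈ v∈))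

  module ProperUsage = ColourUsage n (λ {k} c → Proper {n} {m} {k} E c) (proper? E) proper-invariant
  module MonoUsage (T : Subset m) = ColourUsage n (MonoOn T) (monoOn? T) (monoOn-invariant T)

  properCoeff : ℕ → ℤ
  properCoeff i = ProperUsage.A (suc (suc i)) i

  χ-binomial : ∀ t → + χ E (suc (suc t)) ≡ binomial properCoeff t 0
  χ-binomial t = trans (length-filter (proper? E) (allMaps n (suc (suc t)))) (ProperUsage.decomposition t)

  -- for colourings monochromatic on T the coefficients are Newton's, with b = #components
  monoCoeff : ∀ T i → MonoUsage.A T (suc (suc i)) i ≡ inner i (numComponents E T)
  monoCoeff T = binomial-injective (λ i → MonoUsage.A T (suc (suc i)) i) (λ i → inner i (numComponents E T))
    (λ t → begin
      binomial (λ i → MonoUsage.A T (suc (suc i)) i) t 0   ≡⟨ sym (MonoUsage.decomposition T t) ⟩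
      Σc n (suc (suc t)) (λ c → ind (monoOn? T c))         ≡⟨ count-monoOn T (suc (suc t)) ⟩
      (+ (suc (suc t))) ℤ.^ numComponents E T               ≡⟨ cong (λ w → (+ w) ℤ.^ numComponents E T) (ℕP.+-comm 2 t) ⟩
      (+ (t ℕ.+ 2)) ℤ.^ numComponents E T                   ≡⟨ sym (inner-newton (numComponents E T) t) ⟩
      binomial (λ i → inner i (numComponents E T)) t 0     ∎)
    where open ≡-Reasoning

  #mono : ∀ {k} → Colouring n k → ℕ
  #mono c = count (λ j → monochromatic? (E j) c)

  proper⇔no-mono : ∀ {k} (c : Colouring n k) → ind (proper? E c) ≡ ind (#mono c ℕP.≟ 0)
  proper⇔no-mono c = ind-cong (proper? E c) (#mono c ℕP.≟ 0)
    (count-none (λ j → monochromatic? (E j) c)) (count-none⁻ (λ j → monochromatic? (E j) c))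

  partialSum-colourings : ∀ i M → partialSum E i M ≡ Σc n (suc (suc i)) (λ c → ind (usesColours? i c) * alt (#mono c) M)
  partialSum-colourings i M = begin
      Σ≤ M (λ a → sign a * Σ≤ n (λ b → + s E a b * inner i b))
    ≡⟨ Σ≤-cong M (λ a _ → cong (sign a *_) (trans (s-weighted-sum E (inner i) a)
         (trans (ΣL-cong S (λ T → cong (ind (∣ T ∣ ℕP.≟ a) *_) (sym (monoCoeff T i)))) (subsets-of-size a)))) ⟩
      Σ≤ M (λ a → sign a * Σc n K (λ c → ind (usesColours? i c) * + (#mono c C a)))
    ≡⟨ Σ≤-cong M (λ a _ → trans (sym (ΣL-*ˡ (allMaps n K) (sign a) _))
                                (ΣL-cong (allMaps n K) (λ c → swap-factors (sign a) (ind (usesColours? i c)) (+ (#mono c C a))))) ⟩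
      Σ≤ M (λ a → Σc n K (λ c → ind (usesColours? i c) * (sign a * + (#mono c C a))))
    ≡⟨ sym (ΣL-Σ≤ (allMaps n K) M _) ⟩
      Σc n K (λ c → Σ≤ M (λ a → ind (usesColours? i c) * (sign a * + (#mono c C a))))
    ≡⟨ ΣL-cong (allMaps n K) (λ c → Σ≤-*ˡ M (ind (usesColours? i c)) _) ⟩
      Σc n K (λ c → ind (usesColours? i c) * alt (#mono c) M) ∎
    where
    open ≡-Reasoning
    K : ℕ
    K = suc (suc i)
    S : List (Subset m)
    S = allSubsets m
    swap-factors : ∀ x y z → x * (y * z) ≡ y * (x * z)
    swap-factors = solve-∀
    subsets-of-size : ∀ a → ΣL S (λ T → ind (∣ T ∣ ℕP.≟ a) * MonoUsage.A T K i)
                          ≡ Σc n K (λ c → ind (usesColours? i c) * + (#mono c C a))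
    subsets-of-size a = begin
        ΣL S (λ T → ind (∣ T ∣ ℕP.≟ a) * MonoUsage.A T K i)
      ≡⟨ ΣL-cong S (λ T → trans (sym (ΣL-*ˡ (allMaps n K) (ind (∣ T ∣ ℕP.≟ a)) _))
                                (ΣL-cong (allMaps n K) (λ c → swap-factors (ind (∣ T ∣ ℕP.≟ a)) (ind (usesColours? i c)) (ind (monoOn? T c))))) ⟩
        ΣL S (λ T → Σc n K (λ c → ind (usesColours? i c) * (ind (∣ T ∣ ℕP.≟ a) * ind (monoOn? T c))))
      ≡⟨ ΣL-comm S (allMaps n K) _ ⟩
        Σc n K (λ c → ΣL S (λ T → ind (usesColours? i c) * (ind (∣ T ∣ ℕP.≟ a) * ind (monoOn? T c))))
      ≡⟨ ΣL-cong (allMaps n K) (λ c → trans (ΣL-*ˡ S (ind (usesColours? i c)) _)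
           (cong (ind (usesColours? i c) *_) (count-subsets m a (λ j → monochromatic? (E j) c)))) ⟩
        Σc n K (λ c → ind (usesColours? i c) * + (#mono c C a)) ∎

  partialSum-complete : ∀ i → partialSum E i m ≡ properCoeff i
  partialSum-complete i = trans (partialSum-colourings i m) (ΣL-cong (allMaps n (suc (suc i))) (λ c →
    cong (ind (usesColours? i c) *_)
         (trans (alt-complete (#mono c) m (count-≤ (λ j → monochromatic? (E j) c))) (sym (proper⇔no-mono c)))))

  partialSum-even : ∀ i M → 2 ∣ M → properCoeff i ℤ.≤ partialSum E i M
  partialSum-even i M 2∣M = subst (properCoeff i ℤ.≤_) (sym (partialSum-colourings i M))
    (ΣL-mono (allMaps n (suc (suc i))) (λ c → ind-*-mono (usesColours? i c)
      (subst (ℤ._≤ alt (#mono c) M) (sym (proper⇔no-mono c)) (alt-even (#mono c) M 2∣M))))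

  partialSum-odd : ∀ i M → ¬ (2 ∣ M) → partialSum E i M ℤ.≤ properCoeff i
  partialSum-odd i M 2∤M = subst (ℤ._≤ properCoeff i) (sym (partialSum-colourings i M))
    (ΣL-mono (allMaps n (suc (suc i))) (λ c → ind-*-mono (usesColours? i c)
      (subst (alt (#mono c) M ℤ.≤_) (sym (proper⇔no-mono c)) (alt-odd (#mono c) M 2∤M))))

  -- more than n colours cannot all be used
  properCoeff-vanishes : ∀ i → n ℕ.< i → properCoeff i ≡ 0ℤ
  properCoeff-vanishes i n<i = ΣL-zero (allMaps n (suc (suc i))) (λ c →
    cong (_* ind (proper? E c)) (ind-no (usesColours? i c) (λ uses → ℕP.<⇒≱ n<i (uses-≤ i c uses))))

  fVector : IsFVectorOfχ+1 E (λ i → partialSum E i m)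
  fVector t = trans (χ-binomial t)
    (trans (binomial-truncate n t properCoeff properCoeff-vanishes)
           (Σ≤-cong n (λ i _ → cong (_* + (t C i)) (sym (partialSum-complete i)))))

  fVector-unique : ∀ f → IsFVectorOfχ+1 E f → ∀ i → i ℕ.≤ n → f i ≡ partialSum E i m
  fVector-unique f f-fVector = coordinates-unique n f (λ i → partialSum E i m)
    (λ t → trans (sym (f-fVector t)) (fVector t))

  -- with i ≥ n-l+2 colours in use every colouring is proper: only S = ∅ contributes
  properCoeff-large : ∀ l → (∀ j → l ℕ.≤ ∣ E j ∣) → ∀ i → n ∸ l ℕ.+ 2 ℕ.≤ i → properCoeff i ≡ inner i n
  properCoeff-large l l≤E i i-large =
    trans (ΣL-cong (allMaps n (suc (suc i))) always-proper)
          (trans (monoCoeff ∅ i) (cong (inner i) (numComponents-empty E ∅ (λ j → ∉⊥))))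
    where
    always-proper : ∀ c → ind (usesColours? i c) * ind (proper? E c) ≡ ind (usesColours? i c) * ind (monoOn? ∅ c)
    always-proper c with usesColours? i c
    ... | yes uses = cong (1ℤ *_) (trans (ind-yes (proper? E c) (uses-proper E l l≤E i c i-large uses))
                                         (sym (ind-yes (monoOn? ∅ c) (λ j j∈∅ → ⊥-elim (∉⊥ j∈∅)))))
    ... | no _     = refl

theorem4p4 : (n : ℕ) → 1 ℕ.≤ n → (m : ℕ) → (E : Fin m → Subset n) →
    Injective _≡_ _≡_ E → (∀ j → 2 ℕ.≤ ∣ E j ∣) →
    (∃ λ (f : ℕ → ℤ) → IsFVectorOfχ+1 E f) ×
    (∀ (f : ℕ → ℤ) → IsFVectorOfχ+1 E f →
      (∀ i → i ℕ.≤ n → f i ≡ partialSum E i m) ×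
      (∀ i → i ℕ.≤ n → ∀ M → M ℕ.≤ m → 2 ∣ M → f i ℤ.≤ partialSum E i M) ×
      (∀ i → i ℕ.≤ n → ∀ M → M ℕ.≤ m → ¬ (2 ∣ M) → partialSum E i M ℤ.≤ f i) ×
      (∀ l → (Σ (Fin m) λ j → ∣ E j ∣ ≡ l) → (∀ j → l ℕ.≤ ∣ E j ∣) →
        ∀ i → n ∸ l ℕ.+ 2 ℕ.≤ i → i ℕ.≤ n →
        f i ≡ Σ≤ i (λ j → sign j * + (i C j) * (+ (i ∸ j ℕ.+ 2)) ℤ.^ n)))
theorem4p4 n _ m E _ _ = ((λ i → partialSum E i m) , fVector) , λ f f-fVector →
  let f≡properCoeff : ∀ i → i ℕ.≤ n → f i ≡ properCoeff i
      f≡properCoeff i i≤n = trans (fVector-unique f f-fVector i i≤n) (partialSum-complete i)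
  in fVector-unique f f-fVector
   , (λ i i≤n M _ 2∣M → subst (ℤ._≤ partialSum E i M) (sym (f≡properCoeff i i≤n)) (partialSum-even i M 2∣M))
   , (λ i i≤n M _ 2∤M → subst (partialSum E i M ℤ.≤_) (sym (f≡properCoeff i i≤n)) (partialSum-odd i M 2∤M))
   , (λ l _ l≤E i i-large i≤n → trans (f≡properCoeff i i≤n) (properCoeff-large l l≤E i i-large))
  where open Hypergraph E
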